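{- Let $D^-$ be the additive code defined in the context and $B^-=\phi((D^-)^\perp)^\perp$. Then $B^-$ is a completely regular binary linear code with parameters $[33,23,3]$, whose dual has weight distribution $[\langle0,1\rangle,\langle12,198\rangle,\langle16,495\rangle,\langle20,330\rangle]$, and whose weight distribution is $[\langle0,1\rangle,\langle3,11\rangle,\langle5,198\rangle,\langle6,1243\rangle,\langle7,4158\rangle,\langle8,13563\rangle,\langle9,38445\rangle,\langle10,88638\rangle,\langle11,185397\rangle,\langle12,352902\rangle,\langle13,568788\rangle,\langle14,786885\rangle,\langle15,998052\rangle,\langle16,1156023\rangle,\langle17,1156023\rangle,\langle18,998052\rangle,\langle19,786885\rangle,\langle20,568788\rangle,\langle21,352902\rangle,\langle22,185397\rangle,\langle23,88638\rangle,\langle24,38445\rangle,\langle25,13563\rangle,\langle26,4158\rangle,\langle27,1243\rangle,\langle28,198\rangle,\langle30,11\rangle,\langle33,1\rangle]$, where $\langle i,A_i\rangle$ means $A_i$ codewords of weight $i$.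
   Context: $\mathbb{F}_4=\{0,1,\omega,\omega^2\}$ with $\omega^2=\omega+1$; $\mathrm{Tr}(z)=z+z^2$. Duals of additive quaternary codes are with respect to the trace inner product $x*y=\sum_i\mathrm{Tr}(x_iy_i^2)$; binary duals use the standard inner product. $\phi:\mathbb{F}_4\to\mathbb{F}_2^3$, $\phi(a+b\omega)=(b,a+b,a)$ ($a,b\in\mathbb{F}_2$), extended coordinatewise. A binary linear code is completely regular if the weight distribution of each coset depends only on the weight (minimum weight) of the coset. $D^-$ is the $\mathbb{F}_2$-span of the following $12$ vectors of $\mathbb{F}_4^{11}$: $(0,0,0,0,0,\omega^2,\omega^2,0,\omega,1,\omega)$, $(0,0,0,0,0,\omega,0,\omega,\omega,\omega,1)$, $(1,0,0,0,0,1,0,1,\omega^2,\omega^2,1)$, $(\omega,0,0,0,0,0,\omega,1,\omega,\omega,\omega)$, $(0,1,0,0,0,0,1,1,1,\omega^2,\omega^2)$, $(0,\omega,0,0,0,\omega^2,1,\omega^2,\omega,\omega,0)$, $(0,0,1,0,0,\omega,\omega,1,1,0,1)$, $(0,0,\omega,0,0,\omega,1,\omega,\omega^2,\omega^2,0)$, $(0,0,0,1,0,\omega,\omega,\omega,0,1,\omega)$, $(0,0,0,\omega,0,\omega^2,1,1,\omega^2,0,\omega)$, $(0,0,0,0,1,\omega^2,\omega^2,\omega^2,1,0,\omega^2)$, $(0,0,0,0,\omega,\omega,1,0,1,\omega,\omega)$. -}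

module Defs where

open import Data.Bool using (Bool; true; false; _∧_; _xor_; if_then_else_)
open import Data.Nat using (ℕ; zero; suc; _+_; _*_; _≤_; _≟_)
open import Data.Vec using (Vec; []; _∷_; replicate; zipWith; foldr; map; concat)
open import Data.List using (List; length; filter; concatMap)
  renaming ([] to []ᴸ; _∷_ to _∷ᴸ_)
open import Data.Product using (Σ; _×_; _,_; ∃)
open import Relation.Nullary using (¬_; yes; no)
open import Relation.Nullary.Decidable using (_×-dec_)
open import Relation.Unary using (Pred; Decidable)
open import Relation.Binary.PropositionalEquality using (_≡_)
open import Level using (0ℓ)

data F4 : Set where
  𝟎 𝟏 ω ω² : F4

_⊕_ : F4 → F4 → F4
𝟎  ⊕ y  = y
x  ⊕ 𝟎  = x
𝟏  ⊕ 𝟏  = 𝟎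
𝟏  ⊕ ω  = ω²
𝟏  ⊕ ω² = ω
ω  ⊕ 𝟏  = ω²
ω  ⊕ ω  = 𝟎
ω  ⊕ ω² = 𝟏
ω² ⊕ 𝟏  = ω
ω² ⊕ ω  = 𝟏
ω² ⊕ ω² = 𝟎

_⊗_ : F4 → F4 → F4
𝟎  ⊗ y  = 𝟎
𝟏  ⊗ y  = y
ω  ⊗ 𝟎  = 𝟎
ω  ⊗ 𝟏  = ω
ω  ⊗ ω  = ω²
ω  ⊗ ω² = 𝟏
ω² ⊗ 𝟎  = 𝟎
ω² ⊗ 𝟏  = ω²
ω² ⊗ ω  = 𝟏
ω² ⊗ ω² = ω

Tr : F4 → F4
Tr z = z ⊕ (z ⊗ z)

_⊕ᵛ_ : ∀ {n} → Vec F4 n → Vec F4 n → Vec F4 n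
_⊕ᵛ_ = zipWith _⊕_

trIP : ∀ {n} → Vec F4 n → Vec F4 n → F4
trIP x y = foldr _ _⊕_ 𝟎 (zipWith (λ a b → Tr (a ⊗ (b ⊗ b))) x y)

F2comb : ∀ {A : Set} → A → (A → A → A) → ∀ {k} → Vec Bool k → Vec A k → A
F2comb z _+_ []      []       = z
F2comb z _+_ (c ∷ cs) (g ∷ gs) = (if c then g else z) + F2comb z _+_ cs gs

F4span : ∀ {n k} → Vec (Vec F4 n) k → Pred (Vec F4 n) 0ℓ
F4span {n} gs x = ∃ λ c → F2comb (replicate n 𝟎) _⊕ᵛ_ c gs ≡ x

F4dual : ∀ {n} → Pred (Vec F4 n) 0ℓ → Pred (Vec F4 n) 0ℓ
F4dual C x = ∀ y → C y → trIP x y ≡ 𝟎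

_+ᵇ_ : ∀ {n} → Vec Bool n → Vec Bool n → Vec Bool n
_+ᵇ_ = zipWith _xor_

zeroᵇ : ∀ {n} → Vec Bool n
zeroᵇ {n} = replicate n false

_·_ : ∀ {n} → Vec Bool n → Vec Bool n → Bool
x · y = foldr _ _xor_ false (zipWith _∧_ x y)

F2dual : ∀ {n} → Pred (Vec Bool n) 0ℓ → Pred (Vec Bool n) 0ℓ
F2dual C x = ∀ y → C y → x · y ≡ false

wt : ∀ {n} → Vec Bool n → ℕ
wt = foldr _ (λ b m → if b then suc m else m) 0

-- φ : F4 → F2³, φ(a + bω) = (b, a+b, a)

φ₁ : F4 → Vec Bool 3
φ₁ 𝟎  = false ∷ false ∷ false ∷ []
φ₁ 𝟏  = false ∷ true  ∷ true  ∷ []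
φ₁ ω  = true  ∷ true  ∷ false ∷ []
φ₁ ω² = true  ∷ false ∷ true  ∷ []

φ : ∀ {n} → Vec F4 n → Vec Bool (n * 3)
φ x = concat (map φ₁ x)

IsLinear : ∀ {n} → Pred (Vec Bool n) 0ℓ → Set
IsLinear C = C zeroᵇ × (∀ x y → C x → C y → C (x +ᵇ y))

HasDimension : ∀ {n} → Pred (Vec Bool n) 0ℓ → ℕ → Set
HasDimension {n} C k =
  Σ (Vec (Vec Bool n) k) λ b →
    (∀ x → C x → ∃ λ c → F2comb zeroᵇ _+ᵇ_ c b ≡ x)
  × (∀ c → C (F2comb zeroᵇ _+ᵇ_ c b))
  × (∀ c → F2comb zeroᵇ _+ᵇ_ c b ≡ zeroᵇ → c ≡ replicate k false)

-- C has minimum distance d (for a linear code: minimum nonzero weight)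
HasMinDistance : ∀ {n} → Pred (Vec Bool n) 0ℓ → ℕ → Set
HasMinDistance C d =
  (∃ λ x → C x × ¬ (x ≡ zeroᵇ) × wt x ≡ d)
  × (∀ x → C x → ¬ (x ≡ zeroᵇ) → d ≤ wt x)

allVecs : ∀ n → List (Vec Bool n)
allVecs zero    = [] ∷ᴸ []ᴸ
allVecs (suc n) = concatMap (λ v → (false ∷ v) ∷ᴸ (true ∷ v) ∷ᴸ []ᴸ) (allVecs n)

count : ∀ {n} {P : Pred (Vec Bool n) 0ℓ} → Decidable P → ℕ
count {n} dec = length (filter dec (allVecs n))

weightCount : ∀ {n} {C : Pred (Vec Bool n) 0ℓ} → Decidable C → ℕ → ℕ
weightCount dec i = count (λ x → dec x ×-dec (wt x ≟ i))

cosetWeightCount : ∀ {n} {C : Pred (Vec Bool n) 0ℓ} → Decidable C →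
                   Vec Bool n → ℕ → ℕ
cosetWeightCount dec v i = count (λ x → dec (x +ᵇ v) ×-dec (wt x ≟ i))

CosetWeight : ∀ {n} → Pred (Vec Bool n) 0ℓ → Vec Bool n → ℕ → Set
CosetWeight C v w =
  (∃ λ x → C (x +ᵇ v) × wt x ≡ w) × (∀ x → C (x +ᵇ v) → w ≤ wt x)

CompletelyRegular : ∀ {n} (C : Pred (Vec Bool n) 0ℓ) → Decidable C → Set
CompletelyRegular {n} C dec =
  ∀ (u v : Vec Bool n) (w : ℕ) → CosetWeight C u w → CosetWeight C v w →
    ∀ i → cosetWeightCount dec u i ≡ cosetWeightCount dec v i

-- a weight distribution given as a list of pairs ⟨i, A_i⟩ (absent i ↦ 0)
distr : List (ℕ × ℕ) → ℕ → ℕ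
distr []ᴸ              i = 0
distr ((j , a) ∷ᴸ ps) i with j ≟ i
... | yes _ = a
... | no  _ = distr ps i

Dgens : Vec (Vec F4 11) 12
Dgens =
    (𝟎 ∷ 𝟎 ∷ 𝟎 ∷ 𝟎 ∷ 𝟎 ∷ ω² ∷ ω² ∷ 𝟎 ∷ ω ∷ 𝟏 ∷ ω ∷ [])
  ∷ (𝟎 ∷ 𝟎 ∷ 𝟎 ∷ 𝟎 ∷ 𝟎 ∷ ω ∷ 𝟎 ∷ ω ∷ ω ∷ ω ∷ 𝟏 ∷ [])
  ∷ (𝟏 ∷ 𝟎 ∷ 𝟎 ∷ 𝟎 ∷ 𝟎 ∷ 𝟏 ∷ 𝟎 ∷ 𝟏 ∷ ω² ∷ ω² ∷ 𝟏 ∷ [])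
  ∷ (ω ∷ 𝟎 ∷ 𝟎 ∷ 𝟎 ∷ 𝟎 ∷ 𝟎 ∷ ω ∷ 𝟏 ∷ ω ∷ ω ∷ ω ∷ [])
  ∷ (𝟎 ∷ 𝟏 ∷ 𝟎 ∷ 𝟎 ∷ 𝟎 ∷ 𝟎 ∷ 𝟏 ∷ 𝟏 ∷ 𝟏 ∷ ω² ∷ ω² ∷ [])
  ∷ (𝟎 ∷ ω ∷ 𝟎 ∷ 𝟎 ∷ 𝟎 ∷ ω² ∷ 𝟏 ∷ ω² ∷ ω ∷ ω ∷ 𝟎 ∷ [])
  ∷ (𝟎 ∷ 𝟎 ∷ 𝟏 ∷ 𝟎 ∷ 𝟎 ∷ ω ∷ ω ∷ 𝟏 ∷ 𝟏 ∷ 𝟎 ∷ 𝟏 ∷ [])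
  ∷ (𝟎 ∷ 𝟎 ∷ ω ∷ 𝟎 ∷ 𝟎 ∷ ω ∷ 𝟏 ∷ ω ∷ ω² ∷ ω² ∷ 𝟎 ∷ [])
  ∷ (𝟎 ∷ 𝟎 ∷ 𝟎 ∷ 𝟏 ∷ 𝟎 ∷ ω ∷ ω ∷ ω ∷ 𝟎 ∷ 𝟏 ∷ ω ∷ [])
  ∷ (𝟎 ∷ 𝟎 ∷ 𝟎 ∷ ω ∷ 𝟎 ∷ ω² ∷ 𝟏 ∷ 𝟏 ∷ ω² ∷ 𝟎 ∷ ω ∷ [])
  ∷ (𝟎 ∷ 𝟎 ∷ 𝟎 ∷ 𝟎 ∷ 𝟏 ∷ ω² ∷ ω² ∷ ω² ∷ 𝟏 ∷ 𝟎 ∷ ω² ∷ [])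
  ∷ (𝟎 ∷ 𝟎 ∷ 𝟎 ∷ 𝟎 ∷ ω ∷ ω ∷ 𝟏 ∷ 𝟎 ∷ 𝟏 ∷ ω ∷ ω ∷ [])
  ∷ []

D⁻ : Pred (Vec F4 11) 0ℓ
D⁻ = F4span Dgens

φD⁻⊥ : Pred (Vec Bool 33) 0ℓ
φD⁻⊥ u = ∃ λ x → F4dual D⁻ x × φ x ≡ u

B⁻ : Pred (Vec Bool 33) 0ℓ
B⁻ = F2dual φD⁻⊥

B⁻⊥ : Pred (Vec Bool 33) 0ℓ
B⁻⊥ = F2dual B⁻

B⁻⊥-distribution : List (ℕ × ℕ)
B⁻⊥-distribution =
  (0 , 1) ∷ᴸ (12 , 198) ∷ᴸ (16 , 495) ∷ᴸ (20 , 330) ∷ᴸ []ᴸ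

B⁻-distribution : List (ℕ × ℕ)
B⁻-distribution =
  (0 , 1) ∷ᴸ (3 , 11) ∷ᴸ (5 , 198) ∷ᴸ (6 , 1243) ∷ᴸ (7 , 4158) ∷ᴸ
  (8 , 13563) ∷ᴸ (9 , 38445) ∷ᴸ (10 , 88638) ∷ᴸ (11 , 185397) ∷ᴸ
  (12 , 352902) ∷ᴸ (13 , 568788) ∷ᴸ (14 , 786885) ∷ᴸ (15 , 998052) ∷ᴸ
  (16 , 1156023) ∷ᴸ (17 , 1156023) ∷ᴸ (18 , 998052) ∷ᴸ (19 , 786885) ∷ᴸ
  (20 , 568788) ∷ᴸ (21 , 352902) ∷ᴸ (22 , 185397) ∷ᴸ (23 , 88638) ∷ᴸ
  (24 , 38445) ∷ᴸ (25 , 13563) ∷ᴸ (26 , 4158) ∷ᴸ (27 , 1243) ∷ᴸ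
  (28 , 198) ∷ᴸ (30 , 11) ∷ᴸ (33 , 1) ∷ᴸ []ᴸ

module Submission where

-- φ turns the trace form into the dot product: Tr(x y²) = φ(x) · ψ(y) for an F₂-linear ψ. Hence
-- B⁻ contains ψ(D⁻) and the vectors constant on each block of three coordinates, and row reducing
-- these 23 vectors gives a generator matrix G⁻ systematic on 23 coordinates, while
-- H⁻ = φ(basis of (D⁻)^⊥) is systematic on the complementary 10. Two orthogonal matrices that are
-- systematic on complementary coordinate sets span each other's duals, so dim B⁻ = 23,
-- B⁻⊥ = span H⁻, and H⁻ is a parity-check matrix of B⁻. The rest is finite computation: the weight
-- distributions of all 2¹⁰ cosets of B⁻ are tabulated by syndrome, adding one coordinate at a time,
-- and each is checked to be determined by the coset weight; the distribution of B⁻⊥ is tallied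
-- over its 2¹⁰ codewords.

open import Defs
open import Algebra.Bundles using (CommutativeRing)
open import Data.Bool using (Bool; true; false; _∧_; _xor_; if_then_else_)
open import Data.Bool.Properties
  using (xor-assoc; xor-identityˡ; xor-identityʳ; xor-same; ∧-comm; ∧-distribʳ-xor;
         not-¬; xor-∧-commutativeRing)
  renaming (_≟_ to _≟ᵇ_)
open import Algebra.Properties.CommutativeSemigroup
  (CommutativeRing.+-commutativeSemigroup xor-∧-commutativeRing)
  using () renaming (interchange to xor-interchange)
open import Data.Nat using (ℕ; zero; suc; _+_; _*_; _≤_; z≤n; s≤s; _≟_; _≡ᵇ_)
open import Data.Nat.Properties using (+-identityʳ; +-suc; suc-injective; ≤-antisym)
open import Data.Vec using (Vec; []; _∷_; replicate; zipWith; map; head; tail; _++_; concat)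
open import Data.Vec.Properties
  using (zipWith-assoc; zipWith-identityˡ; zipWith-identityʳ; ∷-injective; ∷-injectiveʳ)
  renaming (≡-dec to ≡-decᵛ)
import Data.Vec.Relation.Unary.All as All
open All using (All; []; _∷_)
open import Data.Vec.Relation.Unary.All.Properties using (map⁺; map⁻; ++⁺)
open import Data.List using (List; length; filter; concatMap) renaming ([] to []ᴸ; _∷_ to _∷ᴸ_)
import Data.List as List
open import Data.List.Properties
  using (filter-≐; filter-none; filter-accept; filter-reject) renaming (≡-dec to ≡-decᴸ)
import Data.List.Relation.Unary.All as AllL
import Data.List.Relation.Unary.Any as Any
open Any using (here; there)
open import Data.List.Membership.Propositional using (_∈_)
open import Data.List.Membership.Propositional.Properties using (∈-concatMap⁺; ∈-filter⁺; ∈-filter⁻)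
open import Data.Fin.Subset using (Subset; ∁; ∣_∣)
open import Data.Product using (_×_; _,_; ∃; proj₁; proj₂)
open import Data.Empty using (⊥-elim)
open import Function using (_∘_; _⇔_; mk⇔; case_of_)
open import Function.Bundles using (Equivalence)
open import Relation.Nullary using (¬_; Dec; yes; no; does)
open import Relation.Nullary.Decidable using (_×-dec_; from-yes)
open import Relation.Unary using (Pred; Decidable; _≐_)
open import Relation.Binary.PropositionalEquality
  using (_≡_; _≢_; refl; sym; trans; cong; cong₂; subst; module ≡-Reasoning)
open import Level using (0ℓ)

private
  variable
    n k : ℕ

+ᵇ-assoc : (x y z : Vec Bool n) → (x +ᵇ y) +ᵇ z ≡ x +ᵇ (y +ᵇ z)
+ᵇ-assoc = zipWith-assoc xor-assoc

+ᵇ-identityˡ : (x : Vec Bool n) → zeroᵇ +ᵇ x ≡ x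
+ᵇ-identityˡ = zipWith-identityˡ xor-identityˡ

+ᵇ-identityʳ : (x : Vec Bool n) → x +ᵇ zeroᵇ ≡ x
+ᵇ-identityʳ = zipWith-identityʳ xor-identityʳ

+ᵇ-self : (x : Vec Bool n) → x +ᵇ x ≡ zeroᵇ
+ᵇ-self []      = refl
+ᵇ-self (a ∷ x) = cong₂ _∷_ (xor-same a) (+ᵇ-self x)

+ᵇ-involutive : (x y : Vec Bool n) → x +ᵇ (x +ᵇ y) ≡ y
+ᵇ-involutive x y = begin
  x +ᵇ (x +ᵇ y)  ≡⟨ +ᵇ-assoc x x y ⟨
  (x +ᵇ x) +ᵇ y  ≡⟨ cong (_+ᵇ y) (+ᵇ-self x) ⟩
  zeroᵇ +ᵇ y     ≡⟨ +ᵇ-identityˡ y ⟩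
  y              ∎
  where open ≡-Reasoning

+ᵇ≡0⇒≡ : (x y : Vec Bool n) → x +ᵇ y ≡ zeroᵇ → x ≡ y
+ᵇ≡0⇒≡ x y eq = begin
  x                    ≡⟨ +ᵇ-identityʳ x ⟨
  x +ᵇ zeroᵇ           ≡⟨ cong (x +ᵇ_) eq ⟨
  x +ᵇ (x +ᵇ y)        ≡⟨ +ᵇ-involutive x y ⟩
  y                    ∎
  where open ≡-Reasoning

+ᵇ-++ : ∀ {m} (a b : Vec Bool m) (x y : Vec Bool n) →
        (a ++ x) +ᵇ (b ++ y) ≡ (a +ᵇ b) ++ (x +ᵇ y)
+ᵇ-++ []      []      x y = refl
+ᵇ-++ (a ∷ as) (b ∷ bs) x y = cong ((a xor b) ∷_) (+ᵇ-++ as bs x y)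

·-comm : (x y : Vec Bool n) → x · y ≡ y · x
·-comm []      []      = refl
·-comm (a ∷ x) (b ∷ y) = cong₂ _xor_ (∧-comm a b) (·-comm x y)

·-zeroˡ : (y : Vec Bool n) → zeroᵇ · y ≡ false
·-zeroˡ []      = refl
·-zeroˡ (b ∷ y) = ·-zeroˡ y

·-zeroʳ : (x : Vec Bool n) → x · zeroᵇ ≡ false
·-zeroʳ x = trans (·-comm x zeroᵇ) (·-zeroˡ x)

·-distribʳ-+ᵇ : (x y z : Vec Bool n) → (x +ᵇ y) · z ≡ (x · z) xor (y · z)
·-distribʳ-+ᵇ []      []      []      = refl
·-distribʳ-+ᵇ (a ∷ x) (b ∷ y) (c ∷ z) = begin
  ((a xor b) ∧ c) xor ((x +ᵇ y) · z)
    ≡⟨ cong₂ _xor_ (∧-distribʳ-xor c a b) (·-distribʳ-+ᵇ x y z) ⟩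
  ((a ∧ c) xor (b ∧ c)) xor ((x · z) xor (y · z))
    ≡⟨ xor-interchange (a ∧ c) (b ∧ c) (x · z) (y · z) ⟩
  ((a ∧ c) xor (x · z)) xor ((b ∧ c) xor (y · z))
    ∎
  where open ≡-Reasoning

·-++ : ∀ {m} (a b : Vec Bool m) (x y : Vec Bool n) → (a ++ x) · (b ++ y) ≡ (a · b) xor (x · y)
·-++ []      []      x y = refl
·-++ (a ∷ as) (b ∷ bs) x y =
  trans (cong ((a ∧ b) xor_) (·-++ as bs x y)) (sym (xor-assoc (a ∧ b) (as · bs) (x · y)))

wt≡0⇒≡zeroᵇ : (x : Vec Bool n) → wt x ≡ 0 → x ≡ zeroᵇ
wt≡0⇒≡zeroᵇ []          _  = refl
wt≡0⇒≡zeroᵇ (false ∷ x) eq = cong (false ∷_) (wt≡0⇒≡zeroᵇ x eq)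

wt-zeroᵇ : ∀ n → wt (zeroᵇ {n}) ≡ 0
wt-zeroᵇ zero    = refl
wt-zeroᵇ (suc n) = wt-zeroᵇ n

-- Linear codes and systematic generator matrices

comb : Vec Bool k → Vec (Vec Bool n) k → Vec Bool n
comb = F2comb zeroᵇ _+ᵇ_

F2comb-homomorphic : ∀ {A B : Set} {z₁ : A} {_∙₁_ : A → A → A} {z₂ : B} {_∙₂_ : B → B → B}
  (f : A → B) → f z₁ ≡ z₂ → (∀ x y → f (x ∙₁ y) ≡ f x ∙₂ f y) →
  (c : Vec Bool k) (gs : Vec A k) → f (F2comb z₁ _∙₁_ c gs) ≡ F2comb z₂ _∙₂_ c (map f gs)
F2comb-homomorphic f f-z f-∙ []      []       = f-z
F2comb-homomorphic {z₁ = z₁} {_∙₁_} {z₂} {_∙₂_} f f-z f-∙ (b ∷ c) (g ∷ gs) =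
  trans (f-∙ (if b then g else z₁) _) (cong₂ _∙₂_ (f-if b) (F2comb-homomorphic f f-z f-∙ c gs))
  where
  f-if : ∀ b → f (if b then g else z₁) ≡ (if b then f g else z₂)
  f-if true  = refl
  f-if false = f-z

comb-closed : {C : Pred (Vec Bool n) 0ℓ} → IsLinear C →
              {G : Vec (Vec Bool n) k} → All C G → ∀ c → C (comb c G)
comb-closed (C0 , C+) []         []      = C0
comb-closed (C0 , C+) (Cg ∷ CG) (true  ∷ c) = C+ _ _ Cg (comb-closed (C0 , C+) CG c)
comb-closed (C0 , C+) (Cg ∷ CG) (false ∷ c) = C+ _ _ C0 (comb-closed (C0 , C+) CG c)

module _ {A : Set} {z : A} {_∙_ : A → A → A}
         (identityˡ : ∀ x → z ∙ x ≡ x) (identityʳ : ∀ x → x ∙ z ≡ x) where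

  F2comb-zeroᵇ : (gs : Vec A k) → F2comb z _∙_ zeroᵇ gs ≡ z
  F2comb-zeroᵇ []       = refl
  F2comb-zeroᵇ (g ∷ gs) = trans (identityˡ _) (F2comb-zeroᵇ gs)

  generators-∈-span : (gs : Vec A k) → All (λ g → ∃ λ c → F2comb z _∙_ c gs ≡ g) gs
  generators-∈-span []       = []
  generators-∈-span (g ∷ gs) =
    (true ∷ zeroᵇ , trans (cong (g ∙_) (F2comb-zeroᵇ gs)) (identityʳ g)) ∷
    All.map (λ (c , eq) → false ∷ c , trans (identityˡ _) eq) (generators-∈-span gs)

orthogonal-linear : (y : Vec Bool n) → IsLinear (λ x → x · y ≡ false)
orthogonal-linear y =
  ·-zeroˡ y , λ x x′ x⊥y x′⊥y → trans (·-distribʳ-+ᵇ x x′ y) (cong₂ _xor_ x⊥y x′⊥y)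

F2dual-linear : (C : Pred (Vec Bool n) 0ℓ) → IsLinear (F2dual C)
F2dual-linear C =
  (λ y _ → ·-zeroˡ y) ,
  λ x x′ x⊥C x′⊥C y Cy → proj₂ (orthogonal-linear y) x x′ (x⊥C y Cy) (x′⊥C y Cy)

_⊥_ : Vec Bool n → Vec (Vec Bool n) k → Set
x ⊥ H = All (λ h → x · h ≡ false) H

⊥-linear : (H : Vec (Vec Bool n) k) → IsLinear (_⊥ H)
⊥-linear H =
  All.universal (proj₁ ∘ orthogonal-linear) H ,
  λ x x′ x⊥H x′⊥H →
    All.map (λ {h} (p , q) → proj₂ (orthogonal-linear h) x x′ p q) (All.zip (x⊥H , x′⊥H))

unitRows : ∀ k → Vec (Vec Bool k) k
unitRows zero    = []
unitRows (suc k) = (true ∷ zeroᵇ) ∷ map (false ∷_) (unitRows k)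

comb-unitRows : (c : Vec Bool k) → comb c (unitRows k) ≡ c
comb-unitRows []      = refl
comb-unitRows (b ∷ c) = begin
  (if b then true ∷ zeroᵇ else zeroᵇ) +ᵇ comb c (map (false ∷_) (unitRows _))
    ≡⟨ cong (_ +ᵇ_) (F2comb-homomorphic (false ∷_) refl (λ _ _ → refl) c _) ⟨
  (if b then true ∷ zeroᵇ else zeroᵇ) +ᵇ (false ∷ comb c (unitRows _))
    ≡⟨ cong (λ v → (if b then true ∷ zeroᵇ else zeroᵇ) +ᵇ (false ∷ v)) (comb-unitRows c) ⟩
  (if b then true ∷ zeroᵇ else zeroᵇ) +ᵇ (false ∷ c)
    ≡⟨ leading b ⟩
  b ∷ (zeroᵇ +ᵇ c)
    ≡⟨ cong (b ∷_) (+ᵇ-identityˡ c) ⟩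
  b ∷ c
    ∎
  where
  open ≡-Reasoning
  leading : ∀ b → (if b then true ∷ zeroᵇ else zeroᵇ) +ᵇ (false ∷ c) ≡ b ∷ (zeroᵇ +ᵇ c)
  leading true  = refl
  leading false = refl

⊥-unitRows : (s : Vec Bool k) → s ⊥ unitRows k → s ≡ zeroᵇ
⊥-unitRows []         []          = refl
⊥-unitRows (false ∷ s) (_ ∷ s⊥U)  = cong (false ∷_) (⊥-unitRows s (map⁻ s⊥U))
⊥-unitRows (true ∷ s)  (s⊥e₀ ∷ _) =
  ⊥-elim (not-¬ refl (trans (cong (true xor_) (sym (·-zeroʳ s))) s⊥e₀))

restrict : ∀ {A : Set} (p : Subset n) → Vec A n → Vec A ∣ p ∣
restrict []          []       = []
restrict (true ∷ p)  (x ∷ xs) = x ∷ restrict p xs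
restrict (false ∷ p) (x ∷ xs) = restrict p xs

restrict-+ᵇ : (p : Subset n) (x y : Vec Bool n) → restrict p (x +ᵇ y) ≡ restrict p x +ᵇ restrict p y
restrict-+ᵇ []          []      []      = refl
restrict-+ᵇ (true ∷ p)  (a ∷ x) (b ∷ y) = cong ((a xor b) ∷_) (restrict-+ᵇ p x y)
restrict-+ᵇ (false ∷ p) (a ∷ x) (b ∷ y) = restrict-+ᵇ p x y

restrict-zero : (p : Subset n) → restrict p zeroᵇ ≡ zeroᵇ
restrict-zero []          = refl
restrict-zero (true ∷ p)  = cong (false ∷_) (restrict-zero p)
restrict-zero (false ∷ p) = restrict-zero p

·-restrict-∁ : (p : Subset n) (r y : Vec Bool n) → restrict p r ≡ zeroᵇ →
               r · y ≡ restrict (∁ p) r · restrict (∁ p) y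
·-restrict-∁ []          []      []      _  = refl
·-restrict-∁ (true ∷ p)  (a ∷ r) (b ∷ y) eq with ∷-injective eq
... | refl , eq′ = ·-restrict-∁ p r y eq′
·-restrict-∁ (false ∷ p) (a ∷ r) (b ∷ y) eq = cong ((a ∧ b) xor_) (·-restrict-∁ p r y eq)

restrict-∁-zero : (p : Subset n) (r : Vec Bool n) →
                  restrict p r ≡ zeroᵇ → restrict (∁ p) r ≡ zeroᵇ → r ≡ zeroᵇ
restrict-∁-zero []          []      _  _   = refl
restrict-∁-zero (true ∷ p)  (a ∷ r) eq eq∁ with ∷-injective eq
... | refl , eq′ = cong (false ∷_) (restrict-∁-zero p r eq′ eq∁)
restrict-∁-zero (false ∷ p) (a ∷ r) eq eq∁ with ∷-injective eq∁
... | refl , eq∁′ = cong (false ∷_) (restrict-∁-zero p r eq eq∁′)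

IsSystematicOn : (p : Subset n) → Vec (Vec Bool n) ∣ p ∣ → Set
IsSystematicOn p G = map (restrict p) G ≡ unitRows ∣ p ∣

module _ (p : Subset n) {G : Vec (Vec Bool n) ∣ p ∣} (G-sys : IsSystematicOn p G) where

  restrict-comb : (c : Vec Bool ∣ p ∣) → restrict p (comb c G) ≡ c
  restrict-comb c = begin
    restrict p (comb c G)               ≡⟨ F2comb-homomorphic (restrict p) (restrict-zero p) (restrict-+ᵇ p) c G ⟩
    comb c (map (restrict p) G)         ≡⟨ cong (comb c) G-sys ⟩
    comb c (unitRows ∣ p ∣)             ≡⟨ comb-unitRows c ⟩
    c                                   ∎
    where open ≡-Reasoning

  systematic-independent : (c : Vec Bool ∣ p ∣) → comb c G ≡ zeroᵇ → c ≡ zeroᵇ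
  systematic-independent c eq = trans (sym (restrict-comb c)) (trans (cong (restrict p) eq) (restrict-zero p))

systematic-kernel : (p : Subset n) {H : Vec (Vec Bool n) ∣ ∁ p ∣} → IsSystematicOn (∁ p) H →
                    (r : Vec Bool n) → r ⊥ H → restrict p r ≡ zeroᵇ → r ≡ zeroᵇ
systematic-kernel p {H} H-sys r r⊥H r|p≡0 = restrict-∁-zero p r r|p≡0 (⊥-unitRows s s⊥U)
  where
  s : Vec Bool ∣ ∁ p ∣
  s = restrict (∁ p) r
  s⊥U : s ⊥ unitRows ∣ ∁ p ∣
  s⊥U = subst (s ⊥_) H-sys (map⁺ (All.map (λ {h} e → trans (sym (·-restrict-∁ p r h r|p≡0)) e) r⊥H))

systematic-spans : ∀ {n} (p : Subset n) {G : Vec (Vec Bool n) ∣ p ∣} {H : Vec (Vec Bool n) ∣ ∁ p ∣} →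
                   IsSystematicOn p G → IsSystematicOn (∁ p) H → All (_⊥ H) G →
                   (x : Vec Bool n) → x ⊥ H → comb (restrict p x) G ≡ x
systematic-spans {n} p {G} {H} G-sys H-sys G⊥H x x⊥H =
  sym (+ᵇ≡0⇒≡ x y (systematic-kernel p H-sys (x +ᵇ y) r⊥H r|p≡0))
  where
  y : Vec Bool n
  y = comb (restrict p x) G
  r⊥H : (x +ᵇ y) ⊥ H
  r⊥H = proj₂ (⊥-linear H) x y x⊥H (comb-closed (⊥-linear H) G⊥H (restrict p x))
  r|p≡0 : restrict p (x +ᵇ y) ≡ zeroᵇ
  r|p≡0 = trans (restrict-+ᵇ p x y)
                (trans (cong (restrict p x +ᵇ_) (restrict-comb p G-sys (restrict p x))) (+ᵇ-self _))

_≟ᵛ_ : (x y : Vec Bool n) → Dec (x ≡ y)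
_≟ᵛ_ = ≡-decᵛ _≟ᵇ_

∈-allVecs : (x : Vec Bool n) → x ∈ allVecs n
∈-allVecs []          = here refl
∈-allVecs (false ∷ x) = ∈-concatMap⁺ _ (Any.map (λ { refl → here refl }) (∈-allVecs x))
∈-allVecs (true ∷ x)  = ∈-concatMap⁺ _ (Any.map (λ { refl → there (here refl) }) (∈-allVecs x))

module _ {P : Pred (Vec Bool n) 0ℓ} (P? : Decidable P) where

  count-cong : {Q : Pred (Vec Bool n) 0ℓ} (Q? : Decidable Q) → P ≐ Q → count P? ≡ count Q?
  count-cong Q? P≐Q = cong length (filter-≐ P? Q? P≐Q (allVecs n))

  count-empty : (∀ x → ¬ P x) → count P? ≡ 0
  count-empty ¬P = cong length (filter-none P? (AllL.universal ¬P (allVecs n)))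

  count≢0 : ∀ {x} → P x → count P? ≢ 0
  count≢0 {x} Px = nonempty (∈-filter⁺ P? (∈-allVecs x) Px)
    where
    nonempty : ∀ {xs : List (Vec Bool n)} → x ∈ xs → length xs ≢ 0
    nonempty (here _)  ()
    nonempty (there _) ()

  count-witness : count P? ≢ 0 → ∃ P
  count-witness count≢0 with filter P? (allVecs n) in eq
  ... | []ᴸ     = ⊥-elim (count≢0 refl)
  ... | y ∷ᴸ _ = y , proj₂ (∈-filter⁻ P? {xs = allVecs n} (subst (y ∈_) (sym eq) (here refl)))

count-[] : {P : Pred (Vec Bool 0) 0ℓ} (P? : Decidable P) → count P? ≡ (if does (P? []) then 1 else 0)
count-[] P? with P? []
... | yes _ = refl
... | no _  = refl

count-split : {P : Pred (Vec Bool (suc n)) 0ℓ} (P? : Decidable P) →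
              count P? ≡ count (P? ∘ (false ∷_)) + count (P? ∘ (true ∷_))
count-split {n} P? = interleave (allVecs n)
  where
  interleave : ∀ xs →
    length (filter P? (concatMap (λ v → (false ∷ v) ∷ᴸ (true ∷ v) ∷ᴸ []ᴸ) xs)) ≡
    length (filter (P? ∘ (false ∷_)) xs) + length (filter (P? ∘ (true ∷_)) xs)
  interleave []ᴸ        = refl
  interleave (x ∷ᴸ xs) with does (P? (false ∷ x))
  ... | true with does (P? (true ∷ x))
  ...   | true  = cong suc (trans (cong suc (interleave xs)) (sym (+-suc _ _)))
  ...   | false = cong suc (interleave xs)
  interleave (x ∷ᴸ xs) | false with does (P? (true ∷ x))
  ...   | true  = trans (cong suc (interleave xs)) (sym (+-suc _ _))
  ...   | false = interleave xs

count-partition : {P : Pred (Vec Bool n) 0ℓ} (P? : Decidable P) (b : Vec Bool n → Bool) →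
  count P? ≡ count (λ x → P? x ×-dec (b x ≟ᵇ false)) + count (λ x → P? x ×-dec (b x ≟ᵇ true))
count-partition {n} P? b = partition (allVecs n)
  where
  partition : ∀ xs → length (filter P? xs) ≡
    length (filter (λ x → P? x ×-dec (b x ≟ᵇ false)) xs) +
    length (filter (λ x → P? x ×-dec (b x ≟ᵇ true)) xs)
  partition []ᴸ = refl
  partition (x ∷ᴸ xs) with P? x | b x
  ... | yes _ | false = cong suc (partition xs)
  ... | yes _ | true  = trans (cong suc (partition xs)) (sym (+-suc _ _))
  ... | no _  | false = partition xs
  ... | no _  | true  = partition xs

count-point : {P : Pred (Vec Bool n) 0ℓ} (P? : Decidable P) (v : Vec Bool n) →
              (∀ x → P x → x ≡ v) → count P? ≡ count {0} (λ _ → P? v)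
count-point P? [] _ with P? []
... | yes _ = refl
... | no _  = refl
count-point P? (false ∷ v) P⇒≡v = begin
  count P?                                          ≡⟨ count-split P? ⟩
  count (P? ∘ (false ∷_)) + count (P? ∘ (true ∷_))  ≡⟨ cong₂ _+_ at-v elsewhere ⟩
  count {0} (λ _ → P? (false ∷ v)) + 0              ≡⟨ +-identityʳ _ ⟩
  count {0} (λ _ → P? (false ∷ v))                  ∎
  where
  open ≡-Reasoning
  at-v : count (P? ∘ (false ∷_)) ≡ count {0} (λ _ → P? (false ∷ v))
  at-v = count-point (P? ∘ (false ∷_)) v (λ x → ∷-injectiveʳ ∘ P⇒≡v (false ∷ x))
  elsewhere : count (P? ∘ (true ∷_)) ≡ 0
  elsewhere = count-empty (P? ∘ (true ∷_)) (λ x Px → case P⇒≡v (true ∷ x) Px of λ ())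
count-point P? (true ∷ v) P⇒≡v = begin
  count P?                                          ≡⟨ count-split P? ⟩
  count (P? ∘ (false ∷_)) + count (P? ∘ (true ∷_))  ≡⟨ cong₂ _+_ elsewhere at-v ⟩
  count {0} (λ _ → P? (true ∷ v))                   ∎
  where
  open ≡-Reasoning
  elsewhere : count (P? ∘ (false ∷_)) ≡ 0
  elsewhere = count-empty (P? ∘ (false ∷_)) (λ x Px → case P⇒≡v (false ∷ x) Px of λ ())
  at-v : count (P? ∘ (true ∷_)) ≡ count {0} (λ _ → P? (true ∷ v))
  at-v = count-point (P? ∘ (true ∷_)) v (λ x → ∷-injectiveʳ ∘ P⇒≡v (true ∷ x))

count-retract : ∀ {n k} (f : Vec Bool k → Vec Bool n) (g : Vec Bool n → Vec Bool k) →
                (∀ c → g (f c) ≡ c) → {P : Pred (Vec Bool n) 0ℓ} (P? : Decidable P) →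
                (∀ x → P x → f (g x) ≡ x) → count P? ≡ count (P? ∘ f)
count-retract {k = zero} f g g∘f P? f∘g =
  trans (count-point P? (f []) (λ x Px → sym (trans (cong f (empty (g x))) (f∘g x Px)))) at-f[]
  where
  empty : (v : Vec Bool 0) → [] ≡ v
  empty [] = refl
  at-f[] : count {0} (λ _ → P? (f [])) ≡ count (P? ∘ f)
  at-f[] with P? (f [])
  ... | yes _ = refl
  ... | no _  = refl
count-retract {k = suc k} f g g∘f {P} P? f∘g = begin
  count P?                                              ≡⟨ count-partition P? (head ∘ g) ⟩
  count (P-with false) + count (P-with true)            ≡⟨ cong₂ _+_ (half false) (half true) ⟩
  count (P? ∘ f ∘ (false ∷_)) + count (P? ∘ f ∘ (true ∷_)) ≡⟨ count-split (P? ∘ f) ⟨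
  count (P? ∘ f)                                        ∎
  where
  open ≡-Reasoning
  P-with : (b : Bool) → Decidable (λ x → P x × head (g x) ≡ b)
  P-with b x = P? x ×-dec (head (g x) ≟ᵇ b)
  half : ∀ b → count (P-with b) ≡ count (P? ∘ f ∘ (b ∷_))
  half b = trans
    (count-retract (f ∘ (b ∷_)) (tail ∘ g) (λ c → cong tail (g∘f (b ∷ c))) (P-with b) f∘g′)
    (count-cong (P-with b ∘ f ∘ (b ∷_)) (P? ∘ f ∘ (b ∷_))
                (proj₁ , λ Px → Px , cong head (g∘f (b ∷ _))))
    where
    f∘g′ : ∀ x → P x × head (g x) ≡ b → f (b ∷ tail (g x)) ≡ x
    f∘g′ x (Px , refl) = trans (cong f (head∷tail (g x))) (f∘g x Px)
      where
      head∷tail : (v : Vec Bool (suc k)) → head v ∷ tail v ≡ v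
      head∷tail (_ ∷ _) = refl

-- A weight distribution is stored as the list of its values at weights 0, 1, 2, …; missing
-- entries are 0, so distinct lists can represent the same distribution.
coeff : List ℕ → ℕ → ℕ
coeff []ᴸ       i       = 0
coeff (a ∷ᴸ p) zero    = a
coeff (a ∷ᴸ p) (suc i) = coeff p i

_⊞_ : List ℕ → List ℕ → List ℕ
[]ᴸ       ⊞ q         = q
(a ∷ᴸ p) ⊞ []ᴸ       = a ∷ᴸ p
(a ∷ᴸ p) ⊞ (b ∷ᴸ q) = (a + b) ∷ᴸ (p ⊞ q)

coeff-⊞ : ∀ p q i → coeff (p ⊞ q) i ≡ coeff p i + coeff q i
coeff-⊞ []ᴸ       q         i       = refl
coeff-⊞ (a ∷ᴸ p) []ᴸ       zero    = sym (+-identityʳ a)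
coeff-⊞ (a ∷ᴸ p) []ᴸ       (suc i) = sym (+-identityʳ _)
coeff-⊞ (a ∷ᴸ p) (b ∷ᴸ q) zero    = refl
coeff-⊞ (a ∷ᴸ p) (b ∷ᴸ q) (suc i) = coeff-⊞ p q i

setCoeff : ℕ → ℕ → List ℕ → List ℕ
setCoeff zero    a []ᴸ       = a ∷ᴸ []ᴸ
setCoeff zero    a (_ ∷ᴸ p) = a ∷ᴸ p
setCoeff (suc j) a []ᴸ       = 0 ∷ᴸ setCoeff j a []ᴸ
setCoeff (suc j) a (b ∷ᴸ p) = b ∷ᴸ setCoeff j a p

coeff-setCoeff-≡ : ∀ j a p → coeff (setCoeff j a p) j ≡ a
coeff-setCoeff-≡ zero    a []ᴸ       = refl
coeff-setCoeff-≡ zero    a (_ ∷ᴸ p) = refl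
coeff-setCoeff-≡ (suc j) a []ᴸ       = coeff-setCoeff-≡ j a []ᴸ
coeff-setCoeff-≡ (suc j) a (_ ∷ᴸ p) = coeff-setCoeff-≡ j a p

coeff-setCoeff-≢ : ∀ j a p i → j ≢ i → coeff (setCoeff j a p) i ≡ coeff p i
coeff-setCoeff-≢ zero    a []ᴸ       zero    j≢i = ⊥-elim (j≢i refl)
coeff-setCoeff-≢ zero    a []ᴸ       (suc i) _   = refl
coeff-setCoeff-≢ zero    a (_ ∷ᴸ p) zero    j≢i = ⊥-elim (j≢i refl)
coeff-setCoeff-≢ zero    a (_ ∷ᴸ p) (suc i) _   = refl
coeff-setCoeff-≢ (suc j) a []ᴸ       zero    _   = refl
coeff-setCoeff-≢ (suc j) a []ᴸ       (suc i) j≢i = coeff-setCoeff-≢ j a []ᴸ i (j≢i ∘ cong suc)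
coeff-setCoeff-≢ (suc j) a (_ ∷ᴸ p) zero    _   = refl
coeff-setCoeff-≢ (suc j) a (_ ∷ᴸ p) (suc i) j≢i = coeff-setCoeff-≢ j a p i (j≢i ∘ cong suc)

coefficients : List (ℕ × ℕ) → List ℕ
coefficients []ᴸ              = []ᴸ
coefficients ((j , a) ∷ᴸ ps) = setCoeff j a (coefficients ps)

distr≡coeff : ∀ ps i → distr ps i ≡ coeff (coefficients ps) i
distr≡coeff []ᴸ              i = refl
distr≡coeff ((j , a) ∷ᴸ ps) i with j ≟ i
... | yes refl = sym (coeff-setCoeff-≡ j a _)
... | no j≢i   = trans (distr≡coeff ps i) (sym (coeff-setCoeff-≢ j a _ i j≢i))

tally : List ℕ → List ℕ
tally []ᴸ       = []ᴸ
tally (w ∷ᴸ ws) = setCoeff w (suc (coeff (tally ws) w)) (tally ws)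

count≡coeff-tally : (g : Vec Bool n → ℕ) (i : ℕ) →
                    count (λ x → g x ≟ i) ≡ coeff (tally (List.map g (allVecs n))) i
count≡coeff-tally {n} g i = go (allVecs n)
  where
  go : ∀ xs → length (filter (λ x → g x ≟ i) xs) ≡ coeff (tally (List.map g xs)) i
  go []ᴸ        = refl
  go (x ∷ᴸ xs) with g x ≟ i
  ... | yes refl = trans (cong length (filter-accept (λ y → g y ≟ g x) refl))
                         (trans (cong suc (go xs)) (sym (coeff-setCoeff-≡ (g x) _ _)))
  ... | no gx≢i  = trans (cong length (filter-reject (λ y → g y ≟ i) gx≢i))
                         (trans (go xs) (sym (coeff-setCoeff-≢ (g x) _ _ i gx≢i)))

valuation : List ℕ → ℕ
valuation []ᴸ           = 0
valuation (zero ∷ᴸ p)  = suc (valuation p)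
valuation (suc _ ∷ᴸ _) = 0

valuation-≤ : ∀ p i → coeff p i ≢ 0 → valuation p ≤ i
valuation-≤ []ᴸ           i       p≢0 = ⊥-elim (p≢0 refl)
valuation-≤ (zero ∷ᴸ p)  zero    p≢0 = ⊥-elim (p≢0 refl)
valuation-≤ (zero ∷ᴸ p)  (suc i) p≢0 = s≤s (valuation-≤ p i p≢0)
valuation-≤ (suc _ ∷ᴸ _) i       _   = z≤n

coeff-valuation≢0 : ∀ p i → coeff p i ≢ 0 → coeff p (valuation p) ≢ 0
coeff-valuation≢0 []ᴸ           i       p≢0 = ⊥-elim (p≢0 refl)
coeff-valuation≢0 (zero ∷ᴸ p)  zero    p≢0 = ⊥-elim (p≢0 refl)
coeff-valuation≢0 (zero ∷ᴸ p)  (suc i) p≢0 = coeff-valuation≢0 p i p≢0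
coeff-valuation≢0 (suc _ ∷ᴸ _) i       _   = λ ()

module _ {C : Pred (Vec Bool n) 0ℓ} (C? : Decidable C) where

  weightCount≢0 : ∀ x → C x → weightCount C? (wt x) ≢ 0
  weightCount≢0 x Cx = count≢0 (λ y → C? y ×-dec (wt y ≟ wt x)) (Cx , refl)

  weightCount≡cosetWeightCount-zero : ∀ i → weightCount C? i ≡ cosetWeightCount C? zeroᵇ i
  weightCount≡cosetWeightCount-zero i =
    count-cong (λ x → C? x ×-dec (wt x ≟ i)) (λ x → C? (x +ᵇ zeroᵇ) ×-dec (wt x ≟ i))
               ((λ (Cx , w) → subst C (sym (+ᵇ-identityʳ _)) Cx , w) ,
                    (λ (Cx , w) → subst C (+ᵇ-identityʳ _) Cx , w))

  cosetWeight-zero : C zeroᵇ → CosetWeight C zeroᵇ 0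
  cosetWeight-zero C0 = (zeroᵇ , subst C (sym (+ᵇ-self zeroᵇ)) C0 , wt-zeroᵇ n) , λ _ _ → z≤n

  valuation-cosetWeight : ∀ {u w} (L : List ℕ) → CosetWeight C u w →
                          (∀ i → cosetWeightCount C? u i ≡ coeff L i) → valuation L ≡ w
  valuation-cosetWeight {u} {w} L ((x , Cx+u , wtx≡w) , minimal) counts =
    ≤-antisym (valuation-≤ L w L[w]≢0) w≤valuation
    where
    L[w]≢0 : coeff L w ≢ 0
    L[w]≢0 = subst (_≢ 0) (counts w) (count≢0 (λ y → C? (y +ᵇ u) ×-dec (wt y ≟ w)) (Cx+u , wtx≡w))
    w≤valuation : w ≤ valuation L
    w≤valuation with count-witness (λ y → C? (y +ᵇ u) ×-dec (wt y ≟ valuation L))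
                      (subst (_≢ 0) (sym (counts (valuation L))) (coeff-valuation≢0 L w L[w]≢0))
    ... | y , Cy+u , wty≡v = subst (w ≤_) wty≡v (minimal y Cy+u)

-- Syndromes

syndrome : Vec (Vec Bool n) k → Vec Bool n → Vec Bool k
syndrome H x = map (x ·_) H

syndromeCount : Vec (Vec Bool n) k → Vec Bool k → ℕ → ℕ
syndromeCount H s i = count (λ x → (syndrome H x ≟ᵛ s) ×-dec (wt x ≟ i))

syndrome-+ᵇ : (H : Vec (Vec Bool n) k) (x y : Vec Bool n) →
              syndrome H (x +ᵇ y) ≡ syndrome H x +ᵇ syndrome H y
syndrome-+ᵇ []      x y = refl
syndrome-+ᵇ (h ∷ H) x y = cong₂ _∷_ (·-distribʳ-+ᵇ x y h) (syndrome-+ᵇ H x y)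

syndrome≡0⇒⊥ : (H : Vec (Vec Bool n) k) (x : Vec Bool n) → syndrome H x ≡ zeroᵇ → x ⊥ H
syndrome≡0⇒⊥ []      x _  = []
syndrome≡0⇒⊥ (h ∷ H) x eq = proj₁ (∷-injective eq) ∷ syndrome≡0⇒⊥ H x (proj₂ (∷-injective eq))

⊥⇒syndrome≡0 : (H : Vec (Vec Bool n) k) (x : Vec Bool n) → x ⊥ H → syndrome H x ≡ zeroᵇ
⊥⇒syndrome≡0 []      x []          = refl
⊥⇒syndrome≡0 (h ∷ H) x (x·h ∷ x⊥H) = cong₂ _∷_ x·h (⊥⇒syndrome≡0 H x x⊥H)

syndrome-[] : (H : Vec (Vec Bool 0) k) → syndrome H [] ≡ zeroᵇ
syndrome-[] []       = refl
syndrome-[] ([] ∷ H) = cong (false ∷_) (syndrome-[] H)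

syndrome-false∷ : (H : Vec (Vec Bool (suc n)) k) (x : Vec Bool n) →
                  syndrome H (false ∷ x) ≡ syndrome (map tail H) x
syndrome-false∷ []            x = refl
syndrome-false∷ ((_ ∷ h) ∷ H) x = cong (x · h ∷_) (syndrome-false∷ H x)

syndrome-true∷ : (H : Vec (Vec Bool (suc n)) k) (x : Vec Bool n) →
                 syndrome H (true ∷ x) ≡ map head H +ᵇ syndrome (map tail H) x
syndrome-true∷ []            x = refl
syndrome-true∷ ((a ∷ h) ∷ H) x = cong ((a xor (x · h)) ∷_) (syndrome-true∷ H x)

cosetWeightCount≡syndromeCount : {C : Pred (Vec Bool n) 0ℓ} (C? : Decidable C) (H : Vec (Vec Bool n) k) →
  (∀ x → C x ⇔ x ⊥ H) → ∀ u i → cosetWeightCount C? u i ≡ syndromeCount H (syndrome H u) i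
cosetWeightCount≡syndromeCount {C = C} C? H C⇔⊥H u i =
  count-cong _ (λ x → (syndrome H x ≟ᵛ syndrome H u) ×-dec (wt x ≟ i))
             ((λ (c , w) → to c , w) , (λ (s , w) → from s , w))
  where
  to : ∀ {x} → C (x +ᵇ u) → syndrome H x ≡ syndrome H u
  to {x} c = +ᵇ≡0⇒≡ _ _
    (trans (sym (syndrome-+ᵇ H x u)) (⊥⇒syndrome≡0 H (x +ᵇ u) (Equivalence.to (C⇔⊥H (x +ᵇ u)) c)))
  from : ∀ {x} → syndrome H x ≡ syndrome H u → C (x +ᵇ u)
  from {x} s = Equivalence.from (C⇔⊥H (x +ᵇ u))
    (syndrome≡0⇒⊥ H (x +ᵇ u) (trans (syndrome-+ᵇ H x u) (trans (cong (_+ᵇ syndrome H u) s) (+ᵇ-self _))))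

data Table (A : Set) : ℕ → Set where
  leaf : A → Table A zero
  node : Table A k → Table A k → Table A (suc k)

module _ {A : Set} where

  lookupᵀ : Table A k → Vec Bool k → A
  lookupᵀ (leaf a)     []          = a
  lookupᵀ (node t₀ t₁) (false ∷ s) = lookupᵀ t₀ s
  lookupᵀ (node t₀ t₁) (true ∷ s)  = lookupᵀ t₁ s

  constantᵀ : ∀ k → A → Table A k
  constantᵀ zero    a = leaf a
  constantᵀ (suc k) a = node (constantᵀ k a) (constantᵀ k a)

  pointᵀ : ∀ k → A → A → Table A k
  pointᵀ zero    a z = leaf a
  pointᵀ (suc k) a z = node (pointᵀ k a z) (constantᵀ k z)

  zipWithᵀ : (A → A → A) → Table A k → Table A k → Table A k
  zipWithᵀ f (leaf a)     (leaf b)     = leaf (f a b)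
  zipWithᵀ f (node t₀ t₁) (node u₀ u₁) = node (zipWithᵀ f t₀ u₀) (zipWithᵀ f t₁ u₁)

  translateᵀ : Vec Bool k → Table A k → Table A k
  translateᵀ []          t            = t
  translateᵀ (false ∷ c) (node t₀ t₁) = node (translateᵀ c t₀) (translateᵀ c t₁)
  translateᵀ (true ∷ c)  (node t₀ t₁) = node (translateᵀ c t₁) (translateᵀ c t₀)

  lookup-constantᵀ : ∀ k (a : A) s → lookupᵀ (constantᵀ k a) s ≡ a
  lookup-constantᵀ zero    a []          = refl
  lookup-constantᵀ (suc k) a (false ∷ s) = lookup-constantᵀ k a s
  lookup-constantᵀ (suc k) a (true ∷ s)  = lookup-constantᵀ k a s

  lookup-pointᵀ-zero : ∀ k (a z : A) → lookupᵀ (pointᵀ k a z) zeroᵇ ≡ a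
  lookup-pointᵀ-zero zero    a z = refl
  lookup-pointᵀ-zero (suc k) a z = lookup-pointᵀ-zero k a z

  lookup-pointᵀ-≢ : ∀ k (a z : A) s → s ≢ zeroᵇ → lookupᵀ (pointᵀ k a z) s ≡ z
  lookup-pointᵀ-≢ zero    a z []          s≢0 = ⊥-elim (s≢0 refl)
  lookup-pointᵀ-≢ (suc k) a z (false ∷ s) s≢0 = lookup-pointᵀ-≢ k a z s (s≢0 ∘ cong (false ∷_))
  lookup-pointᵀ-≢ (suc k) a z (true ∷ s)  _   = lookup-constantᵀ k z s

  lookup-zipWithᵀ : (f : A → A → A) (t u : Table A k) (s : Vec Bool k) →
                    lookupᵀ (zipWithᵀ f t u) s ≡ f (lookupᵀ t s) (lookupᵀ u s)
  lookup-zipWithᵀ f (leaf a)     (leaf b)     []          = refl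
  lookup-zipWithᵀ f (node t₀ t₁) (node u₀ u₁) (false ∷ s) = lookup-zipWithᵀ f t₀ u₀ s
  lookup-zipWithᵀ f (node t₀ t₁) (node u₀ u₁) (true ∷ s)  = lookup-zipWithᵀ f t₁ u₁ s

  lookup-translateᵀ : (c : Vec Bool k) (t : Table A k) (s : Vec Bool k) →
                      lookupᵀ (translateᵀ c t) s ≡ lookupᵀ t (c +ᵇ s)
  lookup-translateᵀ []          (leaf a)     []          = refl
  lookup-translateᵀ (false ∷ c) (node t₀ t₁) (false ∷ s) = lookup-translateᵀ c t₀ s
  lookup-translateᵀ (false ∷ c) (node t₀ t₁) (true ∷ s)  = lookup-translateᵀ c t₁ s
  lookup-translateᵀ (true ∷ c)  (node t₀ t₁) (false ∷ s) = lookup-translateᵀ c t₁ s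
  lookup-translateᵀ (true ∷ c)  (node t₀ t₁) (true ∷ s)  = lookup-translateᵀ c t₀ s

  data Allᵀ (P : A → Set) : Table A k → Set where
    leaf : ∀ {a} → P a → Allᵀ P (leaf a)
    node : ∀ {t₀ t₁ : Table A k} → Allᵀ P t₀ → Allᵀ P t₁ → Allᵀ P (node t₀ t₁)

  allᵀ? : {P : A → Set} → (∀ a → Dec (P a)) → (t : Table A k) → Dec (Allᵀ P t)
  allᵀ? P? (leaf a) with P? a
  ... | yes Pa = yes (leaf Pa)
  ... | no ¬Pa = no λ { (leaf Pa) → ¬Pa Pa }
  allᵀ? P? (node t₀ t₁) with allᵀ? P? t₀ | allᵀ? P? t₁
  ... | yes P₀ | yes P₁ = yes (node P₀ P₁)
  ... | no ¬P₀ | _      = no λ { (node P₀ _) → ¬P₀ P₀ }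
  ... | yes _  | no ¬P₁ = no λ { (node _ P₁) → ¬P₁ P₁ }

  lookup-Allᵀ : {P : A → Set} {t : Table A k} → Allᵀ P t → ∀ s → P (lookupᵀ t s)
  lookup-Allᵀ (leaf Pa)       []          = Pa
  lookup-Allᵀ (node P₀ P₁) (false ∷ s) = lookup-Allᵀ P₀ s
  lookup-Allᵀ (node P₀ P₁) (true ∷ s)  = lookup-Allᵀ P₁ s

-- Prepending a coordinate with column c to H: vectors starting with 0 keep syndrome and weight,
-- those starting with 1 have their syndrome translated by c and their weight raised by one.
addColumn : Vec Bool k → Table (List ℕ) k → Table (List ℕ) k
addColumn c t = zipWithᵀ (λ p q → p ⊞ (0 ∷ᴸ q)) t (translateᵀ c t)

syndromeEnumerator : Vec (Vec Bool n) k → Table (List ℕ) k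
syndromeEnumerator {zero}  {k} H = pointᵀ k (1 ∷ᴸ []ᴸ) []ᴸ
syndromeEnumerator {suc n}     H = addColumn (map head H) (syndromeEnumerator (map tail H))

lookup-syndromeEnumerator-[] : (H : Vec (Vec Bool 0) k) →
                               lookupᵀ (syndromeEnumerator H) (syndrome H []) ≡ 1 ∷ᴸ []ᴸ
lookup-syndromeEnumerator-[] {k} H =
  trans (cong (lookupᵀ (pointᵀ k (1 ∷ᴸ []ᴸ) []ᴸ)) (syndrome-[] H)) (lookup-pointᵀ-zero k _ _)

syndromeCount≡coeff : (H : Vec (Vec Bool n) k) (s : Vec Bool k) (i : ℕ) →
                      syndromeCount H s i ≡ coeff (lookupᵀ (syndromeEnumerator H) s) i
syndromeCount≡coeff {zero} {k} H s i =
  trans (count-[] (λ x → (syndrome H x ≟ᵛ s) ×-dec (wt x ≟ i))) (base (syndrome H [] ≟ᵛ s) (0 ≟ i))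
  where
  base : (d : Dec (syndrome H [] ≡ s)) (e : Dec (0 ≡ i)) →
         (if does (d ×-dec e) then 1 else 0) ≡ coeff (lookupᵀ (syndromeEnumerator H) s) i
  base (yes refl) (yes refl) = cong (λ p → coeff p 0) (sym (lookup-syndromeEnumerator-[] H))
  base (yes refl) (no 0≢i)   =
    trans (only-constant i 0≢i) (cong (λ p → coeff p i) (sym (lookup-syndromeEnumerator-[] H)))
    where
    only-constant : ∀ i → 0 ≢ i → 0 ≡ coeff (1 ∷ᴸ []ᴸ) i
    only-constant zero    0≢0 = ⊥-elim (0≢0 refl)
    only-constant (suc i) _   = refl
  base (no H[]≢s) _ =
    sym (cong (λ p → coeff p i) (lookup-pointᵀ-≢ k _ _ s λ s≡0 → H[]≢s (trans (syndrome-[] H) (sym s≡0))))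
syndromeCount≡coeff {suc n} H s i = begin
  syndromeCount H s i
    ≡⟨ count-split (λ x → (syndrome H x ≟ᵛ s) ×-dec (wt x ≟ i)) ⟩
  count (λ x → (syndrome H (false ∷ x) ≟ᵛ s) ×-dec (wt x ≟ i)) +
  count (λ x → (syndrome H (true ∷ x) ≟ᵛ s) ×-dec (suc (wt x) ≟ i))
    ≡⟨ cong₂ _+_ leading-false (leading-true i) ⟩
  coeff (lookupᵀ E s) i + coeff (0 ∷ᴸ lookupᵀ E (c +ᵇ s)) i
    ≡⟨ coeff-⊞ (lookupᵀ E s) _ i ⟨
  coeff (lookupᵀ E s ⊞ (0 ∷ᴸ lookupᵀ E (c +ᵇ s))) i
    ≡⟨ cong (λ p → coeff (lookupᵀ E s ⊞ (0 ∷ᴸ p)) i) (lookup-translateᵀ c E s) ⟨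
  coeff (lookupᵀ E s ⊞ (0 ∷ᴸ lookupᵀ (translateᵀ c E) s)) i
    ≡⟨ cong (λ p → coeff p i) (lookup-zipWithᵀ _ E (translateᵀ c E) s) ⟨
  coeff (lookupᵀ (addColumn c E) s) i
    ∎
  where
  open ≡-Reasoning
  c  = map head H
  H′ = map tail H
  E  = syndromeEnumerator H′
  leading-false : count (λ x → (syndrome H (false ∷ x) ≟ᵛ s) ×-dec (wt x ≟ i)) ≡ coeff (lookupᵀ E s) i
  leading-false = trans
    (count-cong _ (λ x → (syndrome H′ x ≟ᵛ s) ×-dec (wt x ≟ i))
      ((λ {x} (e , w) → trans (sym (syndrome-false∷ H x)) e , w) ,
       (λ {x} (e , w) → trans (syndrome-false∷ H x) e , w)))
    (syndromeCount≡coeff H′ s i)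
  leading-true : ∀ i → count (λ x → (syndrome H (true ∷ x) ≟ᵛ s) ×-dec (suc (wt x) ≟ i)) ≡
                     coeff (0 ∷ᴸ lookupᵀ E (c +ᵇ s)) i
  leading-true zero    = count-empty (λ x → (syndrome H (true ∷ x) ≟ᵛ s) ×-dec (suc (wt x) ≟ 0)) (λ _ ())
  leading-true (suc j) = trans
    (count-cong _ (λ x → (syndrome H′ x ≟ᵛ (c +ᵇ s)) ×-dec (wt x ≟ j))
      ((λ {x} (e , w) → to x e , suc-injective w) , (λ {x} (e , w) → from x e , cong suc w)))
    (syndromeCount≡coeff H′ (c +ᵇ s) j)
    where
    to : ∀ x → syndrome H (true ∷ x) ≡ s → syndrome H′ x ≡ c +ᵇ s
    to x e = trans (sym (+ᵇ-involutive c _)) (cong (c +ᵇ_) (trans (sym (syndrome-true∷ H x)) e))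
    from : ∀ x → syndrome H′ x ≡ c +ᵇ s → syndrome H (true ∷ x) ≡ s
    from x e = trans (syndrome-true∷ H x) (trans (cong (c +ᵇ_) e) (+ᵇ-involutive c s))

module _ {C : Pred (Vec Bool n) 0ℓ} (C? : Decidable C) (H : Vec (Vec Bool n) k) (C⇔⊥H : ∀ x → C x ⇔ x ⊥ H)
         (R : ℕ → List ℕ) (byWeight : Allᵀ (λ p → p ≡ R (valuation p)) (syndromeEnumerator H)) where

  cosetWeightCount-byWeight : ∀ {u w} → CosetWeight C u w → ∀ i → cosetWeightCount C? u i ≡ coeff (R w) i
  cosetWeightCount-byWeight {u} {w} u-w i = begin
    cosetWeightCount C? u i        ≡⟨ counts u i ⟩
    coeff (E u) i                  ≡⟨ cong (λ p → coeff p i) (lookup-Allᵀ byWeight (syndrome H u)) ⟩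
    coeff (R (valuation (E u))) i  ≡⟨ cong (λ m → coeff (R m) i) (valuation-cosetWeight C? (E u) u-w (counts u)) ⟩
    coeff (R w) i                  ∎
    where
    open ≡-Reasoning
    E : Vec Bool n → List ℕ
    E u = lookupᵀ (syndromeEnumerator H) (syndrome H u)
    counts : ∀ u i → cosetWeightCount C? u i ≡ coeff (E u) i
    counts u i = trans (cosetWeightCount≡syndromeCount C? H C⇔⊥H u i) (syndromeCount≡coeff H (syndrome H u) i)

  completelyRegular-bySyndromeTable : CompletelyRegular C C?
  completelyRegular-bySyndromeTable u v w u-w v-w i =
    trans (cosetWeightCount-byWeight u-w i) (sym (cosetWeightCount-byWeight v-w i))

-- The trace form seen through φ

fromBool : Bool → F4
fromBool false = 𝟎
fromBool true  = 𝟏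

fromBool-xor : ∀ a b → fromBool (a xor b) ≡ fromBool a ⊕ fromBool b
fromBool-xor false b     = refl
fromBool-xor true  false = refl
fromBool-xor true  true  = refl

fromBool≡𝟎 : ∀ {b} → fromBool b ≡ 𝟎 → b ≡ false
fromBool≡𝟎 {false} _  = refl
fromBool≡𝟎 {true}  ()

-- ψ(a + bω) = (0, a, a + b), the adjoint of φ for the trace form.
ψ₁ : F4 → Vec Bool 3
ψ₁ 𝟎  = false ∷ false ∷ false ∷ []
ψ₁ 𝟏  = false ∷ true  ∷ true  ∷ []
ψ₁ ω  = false ∷ false ∷ true  ∷ []
ψ₁ ω² = false ∷ true  ∷ false ∷ []

ψ : Vec F4 n → Vec Bool (n * 3)
ψ x = concat (map ψ₁ x)

Tr≡ψ₁·φ₁ : ∀ x y → Tr (x ⊗ (y ⊗ y)) ≡ fromBool (ψ₁ y · φ₁ x)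
Tr≡ψ₁·φ₁ 𝟎  𝟎  = refl
Tr≡ψ₁·φ₁ 𝟎  𝟏  = refl
Tr≡ψ₁·φ₁ 𝟎  ω  = refl
Tr≡ψ₁·φ₁ 𝟎  ω² = refl
Tr≡ψ₁·φ₁ 𝟏  𝟎  = refl
Tr≡ψ₁·φ₁ 𝟏  𝟏  = refl
Tr≡ψ₁·φ₁ 𝟏  ω  = refl
Tr≡ψ₁·φ₁ 𝟏  ω² = refl
Tr≡ψ₁·φ₁ ω  𝟎  = refl
Tr≡ψ₁·φ₁ ω  𝟏  = refl
Tr≡ψ₁·φ₁ ω  ω  = refl
Tr≡ψ₁·φ₁ ω  ω² = refl
Tr≡ψ₁·φ₁ ω² 𝟎  = refl
Tr≡ψ₁·φ₁ ω² 𝟏  = refl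
Tr≡ψ₁·φ₁ ω² ω  = refl
Tr≡ψ₁·φ₁ ω² ω² = refl

trIP≡ψ·φ : (x y : Vec F4 n) → trIP x y ≡ fromBool (ψ y · φ x)
trIP≡ψ·φ []      []      = refl
trIP≡ψ·φ (a ∷ x) (b ∷ y) = begin
  Tr (a ⊗ (b ⊗ b)) ⊕ trIP x y                     ≡⟨ cong₂ _⊕_ (Tr≡ψ₁·φ₁ a b) (trIP≡ψ·φ x y) ⟩
  fromBool (ψ₁ b · φ₁ a) ⊕ fromBool (ψ y · φ x)   ≡⟨ fromBool-xor (ψ₁ b · φ₁ a) (ψ y · φ x) ⟨
  fromBool ((ψ₁ b · φ₁ a) xor (ψ y · φ x))        ≡⟨ cong fromBool (·-++ (ψ₁ b) (φ₁ a) (ψ y) (φ x)) ⟨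
  fromBool (ψ (b ∷ y) · φ (a ∷ x))                ∎
  where open ≡-Reasoning

ψ₁-⊕ : ∀ a b → ψ₁ (a ⊕ b) ≡ ψ₁ a +ᵇ ψ₁ b
ψ₁-⊕ 𝟎  𝟎  = refl
ψ₁-⊕ 𝟎  𝟏  = refl
ψ₁-⊕ 𝟎  ω  = refl
ψ₁-⊕ 𝟎  ω² = refl
ψ₁-⊕ 𝟏  𝟎  = refl
ψ₁-⊕ 𝟏  𝟏  = refl
ψ₁-⊕ 𝟏  ω  = refl
ψ₁-⊕ 𝟏  ω² = refl
ψ₁-⊕ ω  𝟎  = refl
ψ₁-⊕ ω  𝟏  = refl
ψ₁-⊕ ω  ω  = refl
ψ₁-⊕ ω  ω² = refl
ψ₁-⊕ ω² 𝟎  = refl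
ψ₁-⊕ ω² 𝟏  = refl
ψ₁-⊕ ω² ω  = refl
ψ₁-⊕ ω² ω² = refl

ψ-⊕ᵛ : (x y : Vec F4 n) → ψ (x ⊕ᵛ y) ≡ ψ x +ᵇ ψ y
ψ-⊕ᵛ []      []      = refl
ψ-⊕ᵛ (a ∷ x) (b ∷ y) =
  trans (cong₂ _++_ (ψ₁-⊕ a b) (ψ-⊕ᵛ x y)) (sym (+ᵇ-++ (ψ₁ a) (ψ₁ b) (ψ x) (ψ y)))

ψ-zero : ∀ n → ψ (replicate n 𝟎) ≡ zeroᵇ
ψ-zero zero    = refl
ψ-zero (suc n) = cong (λ v → false ∷ false ∷ false ∷ v) (ψ-zero n)

ψ-F2comb : (c : Vec Bool k) (gs : Vec (Vec F4 n) k) →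
           ψ (F2comb (replicate n 𝟎) _⊕ᵛ_ c gs) ≡ comb c (map ψ gs)
ψ-F2comb {n = n} = F2comb-homomorphic ψ (ψ-zero n) ψ-⊕ᵛ

triples : Vec Bool n → Vec Bool (n * 3)
triples b = concat (map (λ a → a ∷ a ∷ a ∷ []) b)

-- Every φ₁ a has even weight.
triples-⊥-φ : (b : Vec Bool n) (x : Vec F4 n) → triples b · φ x ≡ false
triples-⊥-φ []      []      = refl
triples-⊥-φ (a ∷ b) (c ∷ x) =
  trans (·-++ (a ∷ a ∷ a ∷ []) (φ₁ c) (triples b) (φ x)) (cong₂ _xor_ (block a c) (triples-⊥-φ b x))
  where
  block : ∀ a c → (a ∷ a ∷ a ∷ []) · φ₁ c ≡ false
  block false c  = ·-zeroˡ (φ₁ c)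
  block true  𝟎  = refl
  block true  𝟏  = refl
  block true  ω  = refl
  block true  ω² = refl

-- The codes D⁻ and B⁻

D⁻⊥-basis : Vec (Vec F4 11) 10
D⁻⊥-basis =
    (ω² ∷ 𝟎 ∷ 𝟎 ∷ 𝟎 ∷ 𝟎 ∷ 𝟏 ∷ ω ∷ 𝟎 ∷ 𝟏 ∷ 𝟏 ∷ ω² ∷ [])
  ∷ (𝟏 ∷ 𝟎 ∷ 𝟎 ∷ 𝟎 ∷ 𝟎 ∷ 𝟏 ∷ 𝟎 ∷ 𝟏 ∷ ω² ∷ ω² ∷ 𝟏 ∷ [])
  ∷ (𝟎 ∷ ω² ∷ 𝟎 ∷ 𝟎 ∷ 𝟎 ∷ ω² ∷ 𝟎 ∷ ω ∷ ω² ∷ 𝟏 ∷ ω² ∷ [])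
  ∷ (𝟎 ∷ 𝟏 ∷ 𝟎 ∷ 𝟎 ∷ 𝟎 ∷ 𝟎 ∷ 𝟏 ∷ 𝟏 ∷ 𝟏 ∷ ω² ∷ ω² ∷ [])
  ∷ (𝟎 ∷ 𝟎 ∷ ω² ∷ 𝟎 ∷ 𝟎 ∷ 𝟎 ∷ ω² ∷ ω² ∷ ω ∷ ω² ∷ 𝟏 ∷ [])
  ∷ (𝟎 ∷ 𝟎 ∷ 𝟏 ∷ 𝟎 ∷ 𝟎 ∷ ω ∷ ω ∷ 𝟏 ∷ 𝟏 ∷ 𝟎 ∷ 𝟏 ∷ [])
  ∷ (𝟎 ∷ 𝟎 ∷ 𝟎 ∷ ω² ∷ 𝟎 ∷ 𝟏 ∷ ω² ∷ ω² ∷ ω² ∷ 𝟏 ∷ 𝟎 ∷ [])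
  ∷ (𝟎 ∷ 𝟎 ∷ 𝟎 ∷ 𝟏 ∷ 𝟎 ∷ ω ∷ ω ∷ ω ∷ 𝟎 ∷ 𝟏 ∷ ω ∷ [])
  ∷ (𝟎 ∷ 𝟎 ∷ 𝟎 ∷ 𝟎 ∷ ω² ∷ 𝟏 ∷ ω ∷ ω² ∷ 𝟎 ∷ ω ∷ 𝟏 ∷ [])
  ∷ (𝟎 ∷ 𝟎 ∷ 𝟎 ∷ 𝟎 ∷ 𝟏 ∷ ω² ∷ ω² ∷ ω² ∷ 𝟏 ∷ 𝟎 ∷ ω² ∷ [])
  ∷ []

H⁻ : Vec (Vec Bool 33) 10
H⁻ = map φ D⁻⊥-basis

-- The first two bits of φ in each of the first five blocks; since φ ω² = 101 and φ 𝟏 = 011,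
-- H⁻ restricted to these coordinates is the identity matrix.
I⊥ : Subset 33
I⊥ = concat (map (λ b → b ∷ b ∷ false ∷ []) (replicate 5 true ++ replicate 6 false))

K : Vec (Vec Bool 33) 23
K = map ψ Dgens ++ map triples (unitRows 11)

-- G⁻ is the reduction of K to systematic form on ∁ I⊥; row j of G⁻-coefficients says which
-- rows of K add up to row j of G⁻.
G⁻-coefficients : Vec (Vec Bool 23) 23
G⁻-coefficients = map (map (_≡ᵇ 1))
  ( (0 ∷ 0 ∷ 0 ∷ 0 ∷ 0 ∷ 0 ∷ 0 ∷ 0 ∷ 0 ∷ 0 ∷ 0 ∷ 0 ∷ 1 ∷ 0 ∷ 0 ∷ 0 ∷ 0 ∷ 0 ∷ 0 ∷ 0 ∷ 0 ∷ 0 ∷ 0 ∷ [])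
  ∷ (0 ∷ 0 ∷ 0 ∷ 0 ∷ 0 ∷ 0 ∷ 0 ∷ 0 ∷ 0 ∷ 0 ∷ 0 ∷ 0 ∷ 0 ∷ 1 ∷ 0 ∷ 0 ∷ 0 ∷ 0 ∷ 0 ∷ 0 ∷ 0 ∷ 0 ∷ 0 ∷ [])
  ∷ (0 ∷ 0 ∷ 0 ∷ 0 ∷ 0 ∷ 0 ∷ 0 ∷ 0 ∷ 0 ∷ 0 ∷ 0 ∷ 0 ∷ 0 ∷ 0 ∷ 1 ∷ 0 ∷ 0 ∷ 0 ∷ 0 ∷ 0 ∷ 0 ∷ 0 ∷ 0 ∷ [])
  ∷ (0 ∷ 0 ∷ 0 ∷ 0 ∷ 0 ∷ 0 ∷ 0 ∷ 0 ∷ 0 ∷ 0 ∷ 0 ∷ 0 ∷ 0 ∷ 0 ∷ 0 ∷ 1 ∷ 0 ∷ 0 ∷ 0 ∷ 0 ∷ 0 ∷ 0 ∷ 0 ∷ [])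
  ∷ (0 ∷ 0 ∷ 0 ∷ 0 ∷ 0 ∷ 0 ∷ 0 ∷ 0 ∷ 0 ∷ 0 ∷ 0 ∷ 0 ∷ 0 ∷ 0 ∷ 0 ∷ 0 ∷ 1 ∷ 0 ∷ 0 ∷ 0 ∷ 0 ∷ 0 ∷ 0 ∷ [])
  ∷ (1 ∷ 1 ∷ 0 ∷ 0 ∷ 1 ∷ 0 ∷ 1 ∷ 1 ∷ 1 ∷ 1 ∷ 1 ∷ 1 ∷ 0 ∷ 1 ∷ 0 ∷ 0 ∷ 0 ∷ 1 ∷ 0 ∷ 0 ∷ 0 ∷ 0 ∷ 0 ∷ [])
  ∷ (1 ∷ 0 ∷ 0 ∷ 1 ∷ 0 ∷ 0 ∷ 1 ∷ 1 ∷ 0 ∷ 1 ∷ 1 ∷ 0 ∷ 1 ∷ 0 ∷ 0 ∷ 1 ∷ 1 ∷ 0 ∷ 0 ∷ 0 ∷ 0 ∷ 0 ∷ 0 ∷ [])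
  ∷ (0 ∷ 1 ∷ 0 ∷ 1 ∷ 1 ∷ 0 ∷ 0 ∷ 0 ∷ 1 ∷ 0 ∷ 0 ∷ 1 ∷ 1 ∷ 1 ∷ 0 ∷ 1 ∷ 1 ∷ 0 ∷ 0 ∷ 0 ∷ 0 ∷ 0 ∷ 0 ∷ [])
  ∷ (0 ∷ 1 ∷ 1 ∷ 0 ∷ 0 ∷ 0 ∷ 0 ∷ 1 ∷ 0 ∷ 1 ∷ 0 ∷ 1 ∷ 1 ∷ 0 ∷ 1 ∷ 1 ∷ 1 ∷ 0 ∷ 1 ∷ 0 ∷ 0 ∷ 0 ∷ 0 ∷ [])
  ∷ (0 ∷ 0 ∷ 1 ∷ 0 ∷ 1 ∷ 1 ∷ 1 ∷ 1 ∷ 1 ∷ 1 ∷ 1 ∷ 0 ∷ 1 ∷ 0 ∷ 0 ∷ 0 ∷ 1 ∷ 0 ∷ 0 ∷ 0 ∷ 0 ∷ 0 ∷ 0 ∷ [])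
  ∷ (0 ∷ 1 ∷ 0 ∷ 0 ∷ 1 ∷ 1 ∷ 1 ∷ 0 ∷ 1 ∷ 0 ∷ 1 ∷ 1 ∷ 0 ∷ 0 ∷ 1 ∷ 1 ∷ 0 ∷ 0 ∷ 0 ∷ 0 ∷ 0 ∷ 0 ∷ 0 ∷ [])
  ∷ (1 ∷ 0 ∷ 0 ∷ 0 ∷ 1 ∷ 0 ∷ 1 ∷ 0 ∷ 0 ∷ 1 ∷ 0 ∷ 1 ∷ 0 ∷ 1 ∷ 1 ∷ 1 ∷ 1 ∷ 0 ∷ 0 ∷ 1 ∷ 0 ∷ 0 ∷ 0 ∷ [])
  ∷ (1 ∷ 0 ∷ 1 ∷ 1 ∷ 0 ∷ 1 ∷ 1 ∷ 1 ∷ 1 ∷ 1 ∷ 0 ∷ 0 ∷ 0 ∷ 1 ∷ 0 ∷ 0 ∷ 0 ∷ 0 ∷ 0 ∷ 0 ∷ 0 ∷ 0 ∷ 0 ∷ [])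
  ∷ (0 ∷ 0 ∷ 1 ∷ 1 ∷ 1 ∷ 1 ∷ 0 ∷ 1 ∷ 1 ∷ 0 ∷ 0 ∷ 1 ∷ 0 ∷ 0 ∷ 1 ∷ 1 ∷ 1 ∷ 0 ∷ 0 ∷ 0 ∷ 0 ∷ 0 ∷ 0 ∷ [])
  ∷ (1 ∷ 1 ∷ 1 ∷ 1 ∷ 1 ∷ 0 ∷ 1 ∷ 0 ∷ 1 ∷ 0 ∷ 0 ∷ 0 ∷ 0 ∷ 1 ∷ 1 ∷ 1 ∷ 0 ∷ 0 ∷ 0 ∷ 0 ∷ 1 ∷ 0 ∷ 0 ∷ [])
  ∷ (1 ∷ 1 ∷ 1 ∷ 0 ∷ 1 ∷ 1 ∷ 0 ∷ 1 ∷ 0 ∷ 0 ∷ 1 ∷ 1 ∷ 1 ∷ 0 ∷ 1 ∷ 0 ∷ 0 ∷ 0 ∷ 0 ∷ 0 ∷ 0 ∷ 0 ∷ 0 ∷ [])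
  ∷ (0 ∷ 0 ∷ 0 ∷ 1 ∷ 0 ∷ 1 ∷ 1 ∷ 1 ∷ 1 ∷ 0 ∷ 1 ∷ 1 ∷ 1 ∷ 1 ∷ 0 ∷ 1 ∷ 0 ∷ 0 ∷ 0 ∷ 0 ∷ 0 ∷ 0 ∷ 0 ∷ [])
  ∷ (1 ∷ 0 ∷ 1 ∷ 1 ∷ 1 ∷ 1 ∷ 1 ∷ 0 ∷ 0 ∷ 0 ∷ 1 ∷ 0 ∷ 0 ∷ 0 ∷ 1 ∷ 0 ∷ 1 ∷ 0 ∷ 0 ∷ 0 ∷ 0 ∷ 1 ∷ 0 ∷ [])
  ∷ (1 ∷ 1 ∷ 1 ∷ 0 ∷ 1 ∷ 0 ∷ 0 ∷ 0 ∷ 0 ∷ 1 ∷ 1 ∷ 0 ∷ 1 ∷ 1 ∷ 0 ∷ 1 ∷ 1 ∷ 0 ∷ 0 ∷ 0 ∷ 0 ∷ 0 ∷ 0 ∷ [])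
  ∷ (0 ∷ 1 ∷ 0 ∷ 1 ∷ 0 ∷ 1 ∷ 1 ∷ 0 ∷ 0 ∷ 1 ∷ 0 ∷ 0 ∷ 1 ∷ 1 ∷ 1 ∷ 1 ∷ 0 ∷ 0 ∷ 0 ∷ 0 ∷ 0 ∷ 0 ∷ 0 ∷ [])
  ∷ (0 ∷ 1 ∷ 1 ∷ 0 ∷ 0 ∷ 1 ∷ 0 ∷ 0 ∷ 1 ∷ 1 ∷ 1 ∷ 1 ∷ 1 ∷ 1 ∷ 0 ∷ 0 ∷ 0 ∷ 0 ∷ 0 ∷ 0 ∷ 0 ∷ 0 ∷ 1 ∷ [])
  ∷ (1 ∷ 1 ∷ 1 ∷ 1 ∷ 0 ∷ 0 ∷ 0 ∷ 1 ∷ 1 ∷ 1 ∷ 1 ∷ 0 ∷ 0 ∷ 0 ∷ 1 ∷ 0 ∷ 1 ∷ 0 ∷ 0 ∷ 0 ∷ 0 ∷ 0 ∷ 0 ∷ [])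
  ∷ (1 ∷ 0 ∷ 0 ∷ 1 ∷ 0 ∷ 1 ∷ 0 ∷ 1 ∷ 0 ∷ 0 ∷ 0 ∷ 1 ∷ 1 ∷ 1 ∷ 1 ∷ 0 ∷ 1 ∷ 0 ∷ 0 ∷ 0 ∷ 0 ∷ 0 ∷ 0 ∷ [])
  ∷ [])

G⁻ : Vec (Vec Bool 33) 23
G⁻ = map (λ c → comb c K) G⁻-coefficients

H⁻-systematic : IsSystematicOn I⊥ H⁻
H⁻-systematic = refl

H⁻-systematic-∁∁ : IsSystematicOn (∁ (∁ I⊥)) H⁻
H⁻-systematic-∁∁ = refl

G⁻-systematic : IsSystematicOn (∁ I⊥) G⁻
G⁻-systematic = refl

D⁻⊥-basis-⊥-ψDgens : All (λ d → All (λ g → ψ g · φ d ≡ false) Dgens) D⁻⊥-basis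
D⁻⊥-basis-⊥-ψDgens = from-yes (All.all? (λ d → All.all? (λ g → ψ g · φ d ≟ᵇ false) Dgens) D⁻⊥-basis)

-- Compared with the entries of syndromeEnumerator H⁻ as lists: the entry at syndrome 0 has an
-- entry for weight 33, all others stop at weight 32.
cosetDistribution : ℕ → List ℕ
cosetDistribution 0 = coefficients B⁻-distribution
cosetDistribution 1 =
    0 ∷ᴸ 1 ∷ᴸ 1 ∷ᴸ 0 ∷ᴸ 40 ∷ᴸ 226 ∷ᴸ 1050 ∷ᴸ 4305 ∷ᴸ 13761 ∷ᴸ 37135 ∷ᴸ 89759 ∷ᴸ
    190106 ∷ᴸ 347666 ∷ᴸ 558404 ∷ᴸ 798380 ∷ᴸ 1013551 ∷ᴸ 1139919 ∷ᴸ 1139919 ∷ᴸ 1013551 ∷ᴸ 798380 ∷ᴸ 558404 ∷ᴸ 347666 ∷ᴸ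
    190106 ∷ᴸ 89759 ∷ᴸ 37135 ∷ᴸ 13761 ∷ᴸ 4305 ∷ᴸ 1050 ∷ᴸ 226 ∷ᴸ 40 ∷ᴸ 0 ∷ᴸ 1 ∷ᴸ 1 ∷ᴸ []ᴸ
cosetDistribution 2 =
    0 ∷ᴸ 0 ∷ᴸ 1 ∷ᴸ 6 ∷ᴸ 35 ∷ᴸ 227 ∷ᴸ 1104 ∷ᴸ 4189 ∷ᴸ 13502 ∷ᴸ 37630 ∷ᴸ 90475 ∷ᴸ
    189028 ∷ᴸ 346445 ∷ᴸ 559757 ∷ᴸ 799590 ∷ᴸ 1012759 ∷ᴸ 1139556 ∷ᴸ 1139556 ∷ᴸ 1012759 ∷ᴸ 799590 ∷ᴸ 559757 ∷ᴸ 346445 ∷ᴸ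
    189028 ∷ᴸ 90475 ∷ᴸ 37630 ∷ᴸ 13502 ∷ᴸ 4189 ∷ᴸ 1104 ∷ᴸ 227 ∷ᴸ 35 ∷ᴸ 6 ∷ᴸ 1 ∷ᴸ 0 ∷ᴸ []ᴸ
cosetDistribution 3 =
    0 ∷ᴸ 0 ∷ᴸ 0 ∷ᴸ 5 ∷ᴸ 45 ∷ᴸ 237 ∷ᴸ 1061 ∷ᴸ 4146 ∷ᴸ 13602 ∷ᴸ 37730 ∷ᴸ 90354 ∷ᴸ
    188907 ∷ᴸ 346467 ∷ᴸ 559779 ∷ᴸ 799755 ∷ᴸ 1012924 ∷ᴸ 1139292 ∷ᴸ 1139292 ∷ᴸ 1012924 ∷ᴸ 799755 ∷ᴸ 559779 ∷ᴸ 346467 ∷ᴸ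
    188907 ∷ᴸ 90354 ∷ᴸ 37730 ∷ᴸ 13602 ∷ᴸ 4146 ∷ᴸ 1061 ∷ᴸ 237 ∷ᴸ 45 ∷ᴸ 5 ∷ᴸ 0 ∷ᴸ 0 ∷ᴸ []ᴸ
cosetDistribution _ = []ᴸ

Dgens-⊆-D⁻ : All D⁻ Dgens
Dgens-⊆-D⁻ = generators-∈-span (zipWith-identityˡ (λ _ → refl)) (zipWith-identityʳ ⊕-identityʳ) Dgens
  where
  ⊕-identityʳ : ∀ a → a ⊕ 𝟎 ≡ a
  ⊕-identityʳ 𝟎  = refl
  ⊕-identityʳ 𝟏  = refl
  ⊕-identityʳ ω  = refl
  ⊕-identityʳ ω² = refl

D⁻⊥-basis-⊆-D⁻⊥ : All (F4dual D⁻) D⁻⊥-basis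
D⁻⊥-basis-⊆-D⁻⊥ = All.map (λ {d} d⊥Dgens y (c , y≡) → begin
  trIP d y                                            ≡⟨ cong (trIP d) y≡ ⟨
  trIP d (F2comb (replicate 11 𝟎) _⊕ᵛ_ c Dgens)       ≡⟨ trIP≡ψ·φ d _ ⟩
  fromBool (ψ (F2comb (replicate 11 𝟎) _⊕ᵛ_ c Dgens) · φ d)
                                                      ≡⟨ cong (λ v → fromBool (v · φ d)) (ψ-F2comb c Dgens) ⟩
  fromBool (comb c (map ψ Dgens) · φ d)               ≡⟨ cong fromBool (comb-closed (orthogonal-linear (φ d)) (map⁺ {f = ψ} d⊥Dgens) c) ⟩
  𝟎                                                   ∎) D⁻⊥-basis-⊥-ψDgens
  where open ≡-Reasoning

K-⊥-φD⁻⊥ : ∀ d → F4dual D⁻ d → All (λ r → r · φ d ≡ false) K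
K-⊥-φD⁻⊥ d d⊥D⁻ =
  ++⁺ (map⁺ {f = ψ} (All.map (λ {g} g∈D⁻ → fromBool≡𝟎 (trans (sym (trIP≡ψ·φ d g)) (d⊥D⁻ g g∈D⁻)))
                              Dgens-⊆-D⁻))
      (map⁺ {f = triples} (All.universal (λ b → triples-⊥-φ b d) (unitRows 11)))

G⁻-⊆-B⁻ : All B⁻ G⁻
G⁻-⊆-B⁻ = map⁺ {f = λ c → comb c K} (All.universal span-K-⊆-B⁻ G⁻-coefficients)
  where
  span-K-⊆-B⁻ : ∀ c → B⁻ (comb c K)
  span-K-⊆-B⁻ c _ (d , d⊥D⁻ , refl) = comb-closed (orthogonal-linear (φ d)) (K-⊥-φD⁻⊥ d d⊥D⁻) c

H⁻-⊆-φD⁻⊥ : All φD⁻⊥ H⁻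
H⁻-⊆-φD⁻⊥ = map⁺ {f = φ} (All.map (λ {d} d⊥D⁻ → d , d⊥D⁻ , refl) D⁻⊥-basis-⊆-D⁻⊥)

⊆-double-dual : (C : Pred (Vec Bool n) 0ℓ) (x : Vec Bool n) → C x → F2dual (F2dual C) x
⊆-double-dual C x Cx y y⊥C = trans (·-comm x y) (y⊥C x Cx)

B⁻⇒⊥H⁻ : ∀ x → B⁻ x → x ⊥ H⁻
B⁻⇒⊥H⁻ x x⊥ = All.map (x⊥ _) H⁻-⊆-φD⁻⊥

B⁻⊥⇒⊥G⁻ : ∀ x → B⁻⊥ x → x ⊥ G⁻
B⁻⊥⇒⊥G⁻ x x⊥ = All.map (x⊥ _) G⁻-⊆-B⁻

H⁻-⊆-B⁻⊥ : All B⁻⊥ H⁻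
H⁻-⊆-B⁻⊥ = All.map (λ {h} → ⊆-double-dual φD⁻⊥ h) H⁻-⊆-φD⁻⊥

B⁻-spanned : ∀ x → B⁻ x → comb (restrict (∁ I⊥) x) G⁻ ≡ x
B⁻-spanned x Bx =
  systematic-spans (∁ I⊥) G⁻-systematic H⁻-systematic-∁∁ (All.map (λ {g} → B⁻⇒⊥H⁻ g) G⁻-⊆-B⁻) x (B⁻⇒⊥H⁻ x Bx)

B⁻⊥-spanned : ∀ x → B⁻⊥ x → comb (restrict I⊥ x) H⁻ ≡ x
B⁻⊥-spanned x x⊥ =
  systematic-spans I⊥ H⁻-systematic G⁻-systematic (All.map (λ {h} → B⁻⊥⇒⊥G⁻ h) H⁻-⊆-B⁻⊥) x (B⁻⊥⇒⊥G⁻ x x⊥)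

span-H⁻-⊆-B⁻⊥ : ∀ c → B⁻⊥ (comb c H⁻)
span-H⁻-⊆-B⁻⊥ = comb-closed (F2dual-linear B⁻) H⁻-⊆-B⁻⊥

⊥H⁻⇒B⁻ : ∀ x → x ⊥ H⁻ → B⁻ x
⊥H⁻⇒B⁻ x x⊥H⁻ u φu = begin
  x · u                                     ≡⟨ cong (x ·_) (B⁻⊥-spanned u (⊆-double-dual φD⁻⊥ u φu)) ⟨
  x · comb (restrict I⊥ u) H⁻               ≡⟨ ·-comm x _ ⟩
  comb (restrict I⊥ u) H⁻ · x               ≡⟨ comb-closed (orthogonal-linear x) H⁻⊥x (restrict I⊥ u) ⟩
  false                                     ∎
  where
  open ≡-Reasoning
  H⁻⊥x : All (λ h → h · x ≡ false) H⁻
  H⁻⊥x = All.map (λ {h} x·h → trans (·-comm h x) x·h) x⊥H⁻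

B⁻⇔⊥H⁻ : ∀ x → B⁻ x ⇔ x ⊥ H⁻
B⁻⇔⊥H⁻ x = mk⇔ (B⁻⇒⊥H⁻ x) (⊥H⁻⇒B⁻ x)

cosetTable-byWeight : Allᵀ (λ p → p ≡ cosetDistribution (valuation p)) (syndromeEnumerator H⁻)
cosetTable-byWeight =
  from-yes (allᵀ? (λ p → ≡-decᴸ _≟_ p (cosetDistribution (valuation p))) (syndromeEnumerator H⁻))

tally-span-H⁻ : tally (List.map (λ c → wt (comb c H⁻)) (allVecs 10)) ≡ coefficients B⁻⊥-distribution
tally-span-H⁻ = refl

B⁻-dimension : HasDimension B⁻ 23
B⁻-dimension =
  G⁻ ,
  (λ x Bx → restrict (∁ I⊥) x , B⁻-spanned x Bx) ,
  comb-closed (F2dual-linear φD⁻⊥) G⁻-⊆-B⁻ ,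
  systematic-independent (∁ I⊥) G⁻-systematic

B⁻⊥-weightDistribution : (decB⊥ : Decidable B⁻⊥) → ∀ i → weightCount decB⊥ i ≡ distr B⁻⊥-distribution i
B⁻⊥-weightDistribution decB⊥ i = begin
  weightCount decB⊥ i
    ≡⟨ count-retract (λ c → comb c H⁻) (restrict I⊥) (restrict-comb I⊥ H⁻-systematic)
                     (λ x → decB⊥ x ×-dec (wt x ≟ i)) (λ x → B⁻⊥-spanned x ∘ proj₁) ⟩
  count (λ c → decB⊥ (comb c H⁻) ×-dec (wt (comb c H⁻) ≟ i))
    ≡⟨ count-cong (λ c → decB⊥ (comb c H⁻) ×-dec (wt (comb c H⁻) ≟ i)) (λ c → wt (comb c H⁻) ≟ i)
                  (proj₂ , λ {c} w → span-H⁻-⊆-B⁻⊥ c , w) ⟩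
  count (λ c → wt (comb c H⁻) ≟ i)
    ≡⟨ count≡coeff-tally (λ c → wt (comb c H⁻)) i ⟩
  coeff (tally (List.map (λ c → wt (comb c H⁻)) (allVecs 10))) i
    ≡⟨ cong (λ p → coeff p i) tally-span-H⁻ ⟩
  coeff (coefficients B⁻⊥-distribution) i
    ≡⟨ distr≡coeff B⁻⊥-distribution i ⟨
  distr B⁻⊥-distribution i
    ∎
  where open ≡-Reasoning

module _ (decB : Decidable B⁻) where

  B⁻-completelyRegular : CompletelyRegular B⁻ decB
  B⁻-completelyRegular = completelyRegular-bySyndromeTable decB H⁻ B⁻⇔⊥H⁻ cosetDistribution cosetTable-byWeight

  B⁻-weightDistribution : ∀ i → weightCount decB i ≡ distr B⁻-distribution i
  B⁻-weightDistribution i = begin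
    weightCount decB i
      ≡⟨ weightCount≡cosetWeightCount-zero decB i ⟩
    cosetWeightCount decB zeroᵇ i
      ≡⟨ cosetWeightCount-byWeight decB H⁻ B⁻⇔⊥H⁻ cosetDistribution cosetTable-byWeight
                                   (cosetWeight-zero decB (proj₁ (F2dual-linear φD⁻⊥))) i ⟩
    coeff (coefficients B⁻-distribution) i
      ≡⟨ distr≡coeff B⁻-distribution i ⟨
    distr B⁻-distribution i
      ∎
    where open ≡-Reasoning

  B⁻-minDistance : HasMinDistance B⁻ 3
  B⁻-minDistance = (head G⁻ , All.head G⁻-⊆-B⁻ , (λ ()) , refl) , λ x Bx x≢0 → at-least-3 x Bx x≢0 (wt x) refl
    where
    at-least-3 : ∀ x → B⁻ x → x ≢ zeroᵇ → ∀ m → wt x ≡ m → 3 ≤ m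
    at-least-3 x Bx x≢0 0 w = ⊥-elim (x≢0 (wt≡0⇒≡zeroᵇ x w))
    at-least-3 x Bx x≢0 1 w =
      ⊥-elim (weightCount≢0 decB x Bx (trans (cong (weightCount decB) w) (B⁻-weightDistribution 1)))
    at-least-3 x Bx x≢0 2 w =
      ⊥-elim (weightCount≢0 decB x Bx (trans (cong (weightCount decB) w) (B⁻-weightDistribution 2)))
    at-least-3 x Bx x≢0 (suc (suc (suc m))) _ = s≤s (s≤s (s≤s z≤n))

corollary1 : (decB : Decidable B⁻) (decB⊥ : Decidable B⁻⊥) →
      IsLinear B⁻
    × HasDimension B⁻ 23
    × HasMinDistance B⁻ 3
    × CompletelyRegular B⁻ decB
    × (∀ (i : ℕ) → weightCount decB⊥ i ≡ distr B⁻⊥-distribution i)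
    × (∀ (i : ℕ) → weightCount decB i ≡ distr B⁻-distribution i)
corollary1 decB decB⊥ =
    F2dual-linear φD⁻⊥
  , B⁻-dimension
  , B⁻-minDistance decB
  , B⁻-completelyRegular decB
  , B⁻⊥-weightDistribution decB⊥
  , B⁻-weightDistribution decB
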